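{- Let $\alpha\in(0,1)$ be irrational, let $M\ge0$ and let $n$ be an integer with $2\le m:=q_M\le n$ and $n^{[\le M-1]}>0$. Then $f_{\mathrm{left}}$ and $f_{\mathrm{right}}$ are bijective if and only if $k_{\ge M}(n)\equiv M\pmod 2$.
   Context: $\{x\}=x-\lfloor x\rfloor$. Let $\alpha=[0;a_1,a_2,\dots]$, $q_0=1$, $q_1=a_1$, $q_{k+1}=a_{k+1}q_k+q_{k-1}$. Every positive integer $n$ has a unique Ostrowski representation $n=\sum_{k=0}^N b_kq_k$ with $0\le b_0\le a_1-1$, $0\le b_k\le a_{k+1}$ ($k\ge1$), and $b_{k-1}=0$ whenever $b_k=a_{k+1}$; $b_k(n)$ denotes $b_k$. $n^{[\le M-1]}:=\sum_{k=0}^{\min\{M-1,N\}}b_kq_k$ and $k_{\ge M}(n):=\min\{k\ge M:b_k(n)>0\}$. Define $f_{\mathrm{left}},f_{\mathrm{right}}:\{0,\dots,m-1\}\to\{0,\dots,m-1\}$ by: $f_{\mathrm{left}}(\ell)$ is the unique $j\in\{0,\dots,m-1\}$ minimizing $\{(n+\ell-j)\alpha\}$, and $f_{\mathrm{right}}(\ell)$ is the unique $j\in\{0,\dots,m-1\}$ minimizing $\{(j-n-\ell)\alpha\}$. -}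

module Defs where

open import Data.Nat as ℕ using (ℕ; zero; suc)
open import Data.Integer as ℤ using (ℤ; +_; -_)
open import Data.Product using (Σ; _×_; _,_)
open import Data.Sum using (_⊎_)
open import Relation.Binary.PropositionalEquality using (_≡_)

-- The irrational α = [0; a 1, a 2, ...] ∈ (0,1) is given by its partial
-- quotients a k (k ≥ 1, all ≥ 1); a 0 is the integer part (= 0).

q : (ℕ → ℕ) → ℕ → ℕ
q a zero = 1
q a (suc zero) = a 1
q a (suc (suc k)) = a (suc (suc k)) ℕ.* q a (suc k) ℕ.+ q a k

p : (ℕ → ℕ) → ℕ → ℕ
p a zero = 0
p a (suc zero) = 1
p a (suc (suc k)) = a (suc (suc k)) ℕ.* p a (suc k) ℕ.+ p a k

-- Since p_{2k}/q_{2k} < α < p_{2k+1}/q_{2k+1}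
-- and these intervals shrink to α, u·α+v > 0 iff the affine function
-- x ↦ u x + v is positive at both endpoints of some such interval.
PosLin : (ℕ → ℕ) → ℤ → ℤ → Set
PosLin a u v = Σ ℕ λ k →
  (ℤ.0ℤ ℤ.< u ℤ.* + p a (2 ℕ.* k) ℤ.+ v ℤ.* + q a (2 ℕ.* k)) ×
  (ℤ.0ℤ ℤ.< u ℤ.* + p a (suc (2 ℕ.* k)) ℤ.+ v ℤ.* + q a (suc (2 ℕ.* k)))

-- "u·α + v ≥ 0" (α irrational, so equality only when u = v = 0)
NonNegLin : (ℕ → ℕ) → ℤ → ℤ → Set
NonNegLin a u v = (u ≡ ℤ.0ℤ × v ≡ ℤ.0ℤ) ⊎ PosLin a u v

IsFloor : (ℕ → ℕ) → ℤ → ℤ → Set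
IsFloor a x c = NonNegLin a x (- c) × PosLin a (- x) (c ℤ.+ ℤ.1ℤ)

FracLt : (ℕ → ℕ) → ℤ → ℤ → Set
FracLt a x y = Σ ℤ λ cx → Σ ℤ λ cy →
  IsFloor a x cx × IsFloor a y cy ×
  PosLin a (y ℤ.- x) (cx ℤ.- cy)   -- (yα - cy) - (xα - cx) > 0

sumBelow : (ℕ → ℕ) → ℕ → ℕ
sumBelow f zero = 0
sumBelow f (suc N) = sumBelow f N ℕ.+ f N

IsOstrowski : (ℕ → ℕ) → ℕ → (ℕ → ℕ) → Set
IsOstrowski a n b =
  (Σ ℕ λ N → (∀ k → N ℕ.< k → b k ≡ 0) ×
             n ≡ sumBelow (λ k → b k ℕ.* q a k) (suc N)) ×
  (b 0 ℕ.≤ a 1 ℕ.∸ 1) ×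
  (∀ k → b (suc k) ℕ.≤ a (suc (suc k))) ×
  (∀ k → b (suc k) ≡ a (suc (suc k)) → b k ≡ 0)

-- n^{[≤ M-1]} = Σ_{k=0}^{min(M-1,N)} b_k q_k  (= Σ_{k<M} b_k q_k since b_k = 0 for k > N)
lowPart : (ℕ → ℕ) → (ℕ → ℕ) → ℕ → ℕ
lowPart a b M = sumBelow (λ k → b k ℕ.* q a k) M

IsKGe : (ℕ → ℕ) → ℕ → ℕ → Set
IsKGe b M K = (M ℕ.≤ K) × (0 ℕ.< b K) × (∀ k → M ℕ.≤ k → k ℕ.< K → b k ≡ 0)

-- Write θ for α (governing f_left) or −α (f_right), with numerators P_k = ±p_k
-- and T_k = |q_k θ − P_k|.  A real number enters only through the signs of forms
-- u θ + v (u, v ∈ ℤ), which the convergents of α decide.  Let m = q_M.  Cutting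
-- the Ostrowski expansion of n at M gives n = L + N with 0 < L = n^[≤M-1] < m and
-- N = Σ_{k ≥ K} b_k q_k, K = k_{≥M}(n); hence (n + ℓ − j) θ ≡ H + (L + ℓ − j) θ
-- (mod 1) with H = Σ_{k ≥ K} b_k (q_k θ − P_k), which has the sign of q_K θ − P_K
-- and |H| < T_{K−1}.  By the best approximation property {(f − j) θ} ≥ T_{M−1}
-- whenever 0 < |f − j| < m, so j is the minimiser for ℓ as soon as
-- H + (L + ℓ − j) θ − c lies in (0, T_{M−1}) for some integer c.  If K ≡ M
-- (mod 2) this makes f(ℓ) ≡ ℓ + L or f(ℓ) ≡ ℓ + L − q_{M−1} (mod m), a rotation;
-- otherwise two positions ℓ and ℓ + q_{M−1} share their minimiser.
module Submission where

open import Data.Product using (Σ; _×_; _,_; proj₁; proj₂)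
open import Data.Sum using (_⊎_; inj₁; inj₂)
open import Data.Empty using (⊥; ⊥-elim)
open import Relation.Binary.PropositionalEquality
open import Relation.Nullary using (¬_; yes; no)
open import Defs

module Ostrowski where
  open import Data.Nat
  open import Data.Nat.Properties

  sumFrom : (ℕ → ℕ) → ℕ → ℕ → ℕ
  sumFrom f K zero    = 0
  sumFrom f K (suc R) = f K + sumFrom f (suc K) R

  sumBelow-+ : ∀ f K R → sumBelow f (K + R) ≡ sumBelow f K + sumFrom f K R
  sumBelow-+ f K zero    = trans (cong (sumBelow f) (+-identityʳ K)) (sym (+-identityʳ _))
  sumBelow-+ f K (suc R) = begin
    sumBelow f (K + suc R)                   ≡⟨ cong (sumBelow f) (+-suc K R) ⟩
    sumBelow f (suc K + R)                   ≡⟨ sumBelow-+ f (suc K) R ⟩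
    sumBelow f K + f K + sumFrom f (suc K) R ≡⟨ +-assoc (sumBelow f K) (f K) _ ⟩
    sumBelow f K + sumFrom f K (suc R)       ∎
    where open ≡-Reasoning

  sumBelow-vanishing : ∀ f {A B} → A ≤ B → (∀ k → A ≤ k → k < B → f k ≡ 0) →
                       sumBelow f B ≡ sumBelow f A
  sumBelow-vanishing f {A} {zero}  z≤n   _   = refl
  sumBelow-vanishing f {A} {suc B} A≤1+B f≡0 with m≤n⇒m<n∨m≡n A≤1+B
  ... | inj₂ refl  = refl
  ... | inj₁ A<1+B = begin
    sumBelow f B + f B ≡⟨ cong₂ _+_ (sumBelow-vanishing f A≤B (λ k A≤k k<B → f≡0 k A≤k (m<n⇒m<1+n k<B)))
                                    (f≡0 B A≤B ≤-refl) ⟩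
    sumBelow f A + 0   ≡⟨ +-identityʳ _ ⟩
    sumBelow f A       ∎
    where
    open ≡-Reasoning
    A≤B : A ≤ B
    A≤B = s≤s⁻¹ A<1+B

  q-pos : ∀ {a} → (∀ k → 1 ≤ a (suc k)) → ∀ k → 0 < q a k
  q-pos a-pos zero          = s≤s z≤n
  q-pos a-pos (suc zero)    = a-pos 0
  q-pos a-pos (suc (suc k)) = ≤-trans (q-pos a-pos k) (m≤n+m _ _)

  q<q-suc : ∀ {a} → (∀ k → 1 ≤ a (suc k)) → ∀ k → 2 ≤ q a (suc k) → q a k < q a (suc k)
  q<q-suc a-pos zero    2≤a₁ = 2≤a₁
  q<q-suc {a} a-pos (suc k) _ = begin-strict
    q a (suc k)                           <⟨ m<m+n (q a (suc k)) (q-pos a-pos k) ⟩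
    q a (suc k) + q a k                   ≤⟨ +-monoˡ-≤ (q a k) (m≤m*n (q a (suc k)) (a (suc (suc k)))
                                                                {{>-nonZero (a-pos (suc k))}}) ⟩
    q a (suc k) * a (suc (suc k)) + q a k ≡⟨ cong (_+ q a k) (*-comm (q a (suc k)) _) ⟩
    q a (suc (suc k))                     ∎
    where open ≤-Reasoning

  module Digits {a : ℕ → ℕ} (a-pos : ∀ k → 1 ≤ a (suc k))
                {n : ℕ} {b : ℕ → ℕ} (ost : IsOstrowski a n b) where

    top : ℕ
    top = proj₁ (proj₁ ost)

    digit-vanishes : ∀ k → top < k → b k ≡ 0
    digit-vanishes = proj₁ (proj₂ (proj₁ ost))

    digit≤ : ∀ k → b (suc k) ≤ a (suc (suc k))
    digit≤ = proj₁ (proj₂ (proj₂ ost))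

    private
      n≡digitSum : n ≡ sumBelow (λ k → b k * q a k) (suc top)
      n≡digitSum = proj₂ (proj₂ (proj₁ ost))

      digit₀<a₁ : b 0 < a 1
      digit₀<a₁ = ≤-<-trans (proj₁ (proj₂ ost)) (subst (a 1 ∸ 1 <_) (m+[n∸m]≡n (a-pos 0)) ≤-refl)

      maximal⇒previous≡0 : ∀ k → b (suc k) ≡ a (suc (suc k)) → b k ≡ 0
      maximal⇒previous≡0 = proj₂ (proj₂ (proj₂ ost))

      lowPart-maximal : ∀ k → b (suc k) ≡ a (suc (suc k)) → lowPart a b (suc k) ≡ lowPart a b k
      lowPart-maximal k maximal = begin
        lowPart a b k + b k * q a k   ≡⟨ cong (λ d → lowPart a b k + d * q a k) (maximal⇒previous≡0 k maximal) ⟩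
        lowPart a b k + 0             ≡⟨ +-identityʳ _ ⟩
        lowPart a b k                 ∎
        where open ≡-Reasoning

      lowPart<q-step : ∀ k → lowPart a b k < q a k → lowPart a b (suc k) < q a (suc k) →
                       lowPart a b (suc (suc k)) < q a (suc (suc k))
      lowPart<q-step k low<q low′<q′ with b (suc k) ≟ a (suc (suc k))
      ... | yes maximal = begin-strict
        lowPart a b (suc k) + b (suc k) * q a (suc k)
          ≡⟨ cong (_+ b (suc k) * q a (suc k)) (lowPart-maximal k maximal) ⟩
        lowPart a b k + b (suc k) * q a (suc k)       <⟨ +-monoˡ-< _ low<q ⟩
        q a k + b (suc k) * q a (suc k)               ≡⟨ +-comm (q a k) _ ⟩
        b (suc k) * q a (suc k) + q a k               ≡⟨ cong (λ d → d * q a (suc k) + q a k) maximal ⟩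
        q a (suc (suc k))                             ∎
        where open ≤-Reasoning
      ... | no ¬maximal = begin-strict
        lowPart a b (suc k) + b (suc k) * q a (suc k) <⟨ +-monoˡ-< _ low′<q′ ⟩
        suc (b (suc k)) * q a (suc k)                 ≤⟨ *-monoˡ-≤ (q a (suc k)) (≤∧≢⇒< (digit≤ k) ¬maximal) ⟩
        a (suc (suc k)) * q a (suc k)                 ≤⟨ m≤m+n _ _ ⟩
        q a (suc (suc k))                             ∎
        where open ≤-Reasoning

    lowPart<q : ∀ k → lowPart a b k < q a k
    lowPart<q zero          = s≤s z≤n
    lowPart<q (suc zero)    = subst (_< a 1) (sym (*-identityʳ (b 0))) digit₀<a₁
    lowPart<q (suc (suc k)) = lowPart<q-step k (lowPart<q k) (lowPart<q (suc k))

    lowPart<q-pred : ∀ k → b (suc k) ≡ a (suc (suc k)) → lowPart a b (suc k) < q a k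
    lowPart<q-pred k maximal = subst (_< q a k) (sym (lowPart-maximal k maximal)) (lowPart<q k)

    n≡lowPart+tail : ∀ {M K} → IsKGe b M K → n ≡ lowPart a b M + sumFrom (λ k → b k * q a k) K (suc top)
    n≡lowPart+tail {M} {K} (M≤K , _ , gap) = begin
      n                                     ≡⟨ n≡digitSum ⟩
      sumBelow g (suc top)                  ≡⟨ sumBelow-vanishing g (m≤n+m (suc top) K) beyond-top ⟨
      sumBelow g (K + suc top)              ≡⟨ sumBelow-+ g K (suc top) ⟩
      sumBelow g K + sumFrom g K (suc top)  ≡⟨ cong (_+ sumFrom g K (suc top)) (sumBelow-vanishing g M≤K in-gap) ⟩
      lowPart a b M + sumFrom g K (suc top) ∎
      where
      open ≡-Reasoning
      g : ℕ → ℕ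
      g = λ k → b k * q a k
      beyond-top : ∀ k → suc top ≤ k → k < K + suc top → g k ≡ 0
      beyond-top k top<k _ = cong (_* q a k) (digit-vanishes k top<k)
      in-gap : ∀ k → M ≤ k → k < K → g k ≡ 0
      in-gap k M≤k k<K = cong (_* q a k) (gap k M≤k k<K)

module Residues where
  open import Data.Nat
  open import Data.Nat.Properties
  open import Data.Nat.DivMod
  open import Data.Fin using (Fin; toℕ; fromℕ<)
  open import Data.Fin.Properties using (toℕ<n; toℕ-fromℕ<; toℕ-injective)
  open import Function.Definitions using (Injective; Surjective; Bijective)

  %-shift-cancel : ∀ {m} .{{_ : NonZero m}} {c d} k x → c + d ≡ k * m → x < m →
                   ((x + c) % m + d) % m ≡ x
  %-shift-cancel {m} {c} {d} k x c+d≡km x<m = begin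
    ((x + c) % m + d) % m         ≡⟨ %-distribˡ-+ ((x + c) % m) d m ⟩
    ((x + c) % m % m + d % m) % m ≡⟨ cong (λ r → (r + d % m) % m) (m%n%n≡m%n (x + c) m) ⟩
    ((x + c) % m + d % m) % m     ≡⟨ %-distribˡ-+ (x + c) d m ⟨
    (x + c + d) % m               ≡⟨ cong (_% m) (trans (+-assoc x c d) (cong (x +_) c+d≡km)) ⟩
    (x + k * m) % m               ≡⟨ [m+kn]%n≡m%n x k m ⟩
    x % m                         ≡⟨ m<n⇒m%n≡m x<m ⟩
    x                             ∎
    where open ≡-Reasoning

  rotation-bijective : ∀ {m} .{{_ : NonZero m}} (c : ℕ) (g : Fin m → Fin m) →
                       (∀ ℓ → toℕ (g ℓ) ≡ (toℕ ℓ + c) % m) → Bijective _≡_ _≡_ g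
  rotation-bijective {m} c g g≡rotation = injective , surjective
    where
    -- rotating by d = c (m − 1) undoes the rotation by c
    d : ℕ
    d = c * (m ∸ 1)
    c+d≡cm : c + d ≡ c * m
    c+d≡cm = begin
      c + c * (m ∸ 1)     ≡⟨ cong (_+ c * (m ∸ 1)) (*-identityʳ c) ⟨
      c * 1 + c * (m ∸ 1) ≡⟨ *-distribˡ-+ c 1 (m ∸ 1) ⟨
      c * (1 + (m ∸ 1))   ≡⟨ cong (c *_) (m+[n∸m]≡n (>-nonZero⁻¹ m)) ⟩
      c * m               ∎
      where open ≡-Reasoning
    unrotate : ∀ ℓ → (toℕ (g ℓ) + d) % m ≡ toℕ ℓ
    unrotate ℓ = trans (cong (λ r → (r + d) % m) (g≡rotation ℓ)) (%-shift-cancel c (toℕ ℓ) c+d≡cm (toℕ<n ℓ))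
    injective : Injective _≡_ _≡_ g
    injective {x} {y} gx≡gy = toℕ-injective (begin
      toℕ x               ≡⟨ unrotate x ⟨
      (toℕ (g x) + d) % m ≡⟨ cong (λ z → (toℕ z + d) % m) gx≡gy ⟩
      (toℕ (g y) + d) % m ≡⟨ unrotate y ⟩
      toℕ y               ∎)
      where open ≡-Reasoning
    surjective : Surjective _≡_ _≡_ g
    surjective j = ℓ , λ { refl → toℕ-injective (begin
      toℕ (g ℓ)                 ≡⟨ g≡rotation ℓ ⟩
      (toℕ ℓ + c) % m           ≡⟨ cong (λ r → (r + c) % m) (toℕ-fromℕ< (m%n<n (toℕ j + d) m)) ⟩
      ((toℕ j + d) % m + c) % m ≡⟨ %-shift-cancel c (toℕ j) (trans (+-comm d c) c+d≡cm) (toℕ<n j) ⟩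
      toℕ j                     ∎) }
      where
      open ≡-Reasoning
      ℓ : Fin m
      ℓ = fromℕ< (m%n<n (toℕ j + d) m)

  private
    complement-fills : ∀ {m L q} → L + q ≤ m → L + (m ∸ (L + q)) + q ≡ m
    complement-fills {m} {L} {q} L+q≤m = begin
      L + (m ∸ (L + q)) + q ≡⟨ cong (_+ q) (+-comm L _) ⟩
      m ∸ (L + q) + L + q   ≡⟨ +-assoc (m ∸ (L + q)) L q ⟩
      m ∸ (L + q) + (L + q) ≡⟨ m∸n+n≡m L+q≤m ⟩
      m                     ∎
      where open ≡-Reasoning

    complement+q<m : ∀ {m L q} → 0 < L → L + q ≤ m → m ∸ (L + q) + q < m
    complement+q<m {m} {L} {q} 0<L L+q≤m = begin-strict
      m ∸ (L + q) + q       <⟨ m<n+m _ 0<L ⟩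
      L + (m ∸ (L + q) + q) ≡⟨ +-assoc L _ q ⟨
      L + (m ∸ (L + q)) + q ≡⟨ complement-fills {m} {L} {q} L+q≤m ⟩
      m                     ∎
      where open ≤-Reasoning

  -- Positions ℓ and ℓ + q below m and a common target j (j = L + ℓ in the second
  -- lemma) for the two non-rotating cases of the minimiser analysis.
  collision-window-low : ∀ {m L q} → 0 < L → L < m → 0 < q → q < m →
                         Σ ℕ λ ℓ → Σ ℕ λ j → ℓ + q < m × j < q × L + ℓ + q ≡ j + m
  collision-window-low {m} {L} {q} 0<L L<m 0<q q<m with m ≤? L + q
  ... | yes m≤L+q = 0 , L + q ∸ m , q<m , j<q , trans (cong (_+ q) (+-identityʳ L)) (sym (m∸n+n≡m m≤L+q))
    where
    j<q : L + q ∸ m < q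
    j<q = +-cancelʳ-< m _ q (begin-strict
      L + q ∸ m + m ≡⟨ m∸n+n≡m m≤L+q ⟩
      L + q         <⟨ +-monoˡ-< q L<m ⟩
      m + q         ≡⟨ +-comm m q ⟩
      q + m         ∎)
      where open ≤-Reasoning
  ... | no m≰L+q = m ∸ (L + q) , 0 , complement+q<m {m} {L} {q} 0<L L+q≤m , 0<q , complement-fills {m} {L} {q} L+q≤m
    where L+q≤m = <⇒≤ (≰⇒> m≰L+q)

  collision-window-high : ∀ {m L q} → 0 < L → L < m → 0 < q → q < m →
                          Σ ℕ λ ℓ → ℓ + q < m × L + ℓ < m × m ≤ L + ℓ + q
  collision-window-high {m} {L} {q} 0<L L<m 0<q q<m with m ≤? L + q
  ... | yes m≤L+q = 0 , q<m , subst (_< m) (sym (+-identityʳ L)) L<m ,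
                    subst (λ x → m ≤ x + q) (sym (+-identityʳ L)) m≤L+q
  ... | no m≰L+q = m ∸ (L + q) , complement+q<m {m} {L} {q} 0<L L+q≤m , L+ℓ<m ,
                   ≤-reflexive (sym (complement-fills {m} {L} {q} L+q≤m))
    where
    L+q≤m : L + q ≤ m
    L+q≤m = <⇒≤ (≰⇒> m≰L+q)
    L+ℓ<m : L + (m ∸ (L + q)) < m
    L+ℓ<m = begin-strict
      L + (m ∸ (L + q))     <⟨ m<m+n _ 0<q ⟩
      L + (m ∸ (L + q)) + q ≡⟨ complement-fills {m} {L} {q} L+q≤m ⟩
      m                     ∎
      where open ≤-Reasoning

open Ostrowski
open Residues

open import Data.Nat as ℕ using (ℕ; zero; suc)
import Data.Nat.Properties as ℕ
open import Data.Nat.DivMod using (_%_; _/_; m≡m%n+[m/n]*n; m%n<n; [m+n]%n≡m%n)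
import Data.Nat.Tactic.RingSolver as ℕ-Ring
open import Data.Integer as ℤ using (ℤ; +_; -[1+_]; +[1+_]; 0ℤ; 1ℤ; -1ℤ; _+_; _-_; -_; _*_)
import Data.Integer.Properties as ℤ
open import Data.Integer.Tactic.RingSolver using (solve-∀)
open import Data.Fin as Fin using (Fin; toℕ; fromℕ<)
import Data.Fin.Properties as Fin
open import Function.Definitions using (Injective; Bijective)
open import Relation.Binary.Bundles using (StrictPartialOrder)
import Relation.Binary.Reasoning.StrictPartialOrder

1≢-1 : 1ℤ ≢ -1ℤ
1≢-1 ()

IsUnit : ℤ → Set
IsUnit x = x ≡ 1ℤ ⊎ x ≡ -1ℤ

unit*unit≡1 : ∀ {x} → IsUnit x → x * x ≡ 1ℤ
unit*unit≡1 (inj₁ refl) = refl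
unit*unit≡1 (inj₂ refl) = refl

unit-* : ∀ {x y} → IsUnit x → IsUnit y → IsUnit (x * y)
unit-* (inj₁ refl) (inj₁ refl) = inj₁ refl
unit-* (inj₁ refl) (inj₂ refl) = inj₂ refl
unit-* (inj₂ refl) (inj₁ refl) = inj₂ refl
unit-* (inj₂ refl) (inj₂ refl) = inj₁ refl

<-pos⇒≢ : ∀ {Q N Z} → Q ℕ.≤ N → Z ℤ.< + Q → Z ≢ + N
<-pos⇒≢ Q≤N Z<Q Z≡N = ℤ.<-irrefl refl (ℤ.<-≤-trans (subst (ℤ._< _) Z≡N Z<Q) (ℤ.+≤+ Q≤N))

<-neg⇒≢ : ∀ {Q N Z} → Q ℕ.≤ N → - + Q ℤ.< Z → Z ≢ - + N
<-neg⇒≢ Q≤N -Q<Z Z≡-N = ℤ.<-irrefl refl (ℤ.<-≤-trans (ℤ.neg-cancel-< (subst (_ ℤ.<_) Z≡-N -Q<Z)) (ℤ.+≤+ Q≤N))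

pos-∸ : ∀ {m n} → n ℕ.≤ m → + (m ℕ.∸ n) ≡ + m - + n
pos-∸ {m} {n} n≤m = sym (trans (ℤ.m-n≡m⊖n m n) (ℤ.⊖-≥ n≤m))

balance⇒difference : ∀ {x y u w} → x ℕ.+ u ≡ y ℕ.+ w → + x - + y ≡ + w - + u
balance⇒difference {x} {y} {u} {w} balance = begin
  + x - + y                 ≡⟨ shift (+ x) (+ y) (+ u) ⟩
  (+ x + + u) - (+ y + + u) ≡⟨ cong (λ z → z - (+ y + + u)) (trans (sym (ℤ.pos-+ x u))
                                                            (trans (cong +_ balance) (ℤ.pos-+ y w))) ⟩
  (+ y + + w) - (+ y + + u) ≡⟨ cancel (+ y) (+ w) (+ u) ⟩
  + w - + u                 ∎
  where
  open ≡-Reasoning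
  shift : ∀ x y u → x - y ≡ (x + u) - (y + u)
  shift = solve-∀
  cancel : ∀ y w u → (y + w) - (y + u) ≡ w - u
  cancel = solve-∀

private
  +-rec : ∀ (a f : ℕ → ℕ) → (∀ k → f (suc (suc k)) ≡ a (suc (suc k)) ℕ.* f (suc k) ℕ.+ f k) →
          ∀ k → + f (suc (suc k)) ≡ + a (suc (suc k)) * + f (suc k) + + f k
  +-rec a f f-rec k = trans (cong +_ (f-rec k))
                      (trans (ℤ.pos-+ (a (suc (suc k)) ℕ.* f (suc k)) (f k))
                             (cong (_+ + f k) (ℤ.pos-* (a (suc (suc k))) (f (suc k)))))

+p-rec : ∀ a k → + p a (suc (suc k)) ≡ + a (suc (suc k)) * + p a (suc k) + + p a k
+p-rec a = +-rec a (p a) (λ k → refl)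

+q-rec : ∀ a k → + q a (suc (suc k)) ≡ + a (suc (suc k)) * + q a (suc k) + + q a k
+q-rec a = +-rec a (q a) (λ k → refl)

difference-bounds : ∀ {m f j} → f ℕ.< m → j ℕ.< m → - + m ℤ.< + f - + j × + f - + j ℤ.< + m
difference-bounds {m} {f} {j} f<m j<m =
  subst (- + m ℤ.<_) (swap (+ j) (+ f)) (ℤ.neg-mono-< (below j f j<m)) , below f j f<m
  where
  below : ∀ x y → x ℕ.< m → + x - + y ℤ.< + m
  below x y x<m = subst (ℤ._< + m) (sym (ℤ.m-n≡m⊖n x y)) (ℤ.≤-<-trans (ℤ.m⊖n≤m x y) (ℤ.+<+ x<m))
  swap : ∀ x y → - (x - y) ≡ y - x
  swap = solve-∀

-- Linear forms

-- (u , v) stands for u θ + v; θ is only known through the sign of such forms.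
Form : Set
Form = ℤ × ℤ

infixl 6 _⊕_ _⊖_
infixr 7 _⊙_
infix  8 ⊝_

_⊕_ : Form → Form → Form
x ⊕ y = (proj₁ x + proj₁ y , proj₂ x + proj₂ y)

⊝_ : Form → Form
⊝ x = (- proj₁ x , - proj₂ x)

_⊖_ : Form → Form → Form
x ⊖ y = x ⊕ ⊝ y

_⊙_ : ℤ → Form → Form
k ⊙ x = (k * proj₁ x , k * proj₂ x)

0ᶠ : Form
0ᶠ = (0ℤ , 0ℤ)

1ᶠ : Form
1ᶠ = (0ℤ , 1ℤ)

-- The operations are defined through projections, so an identity between forms
-- is definitionally a pair of integer identities; Agda infers them from the
-- statement and `pointwiseₙ solve-∀` discharges both with the ring solver.
private
  pointwise₁ : ∀ {f g : ℤ → ℤ} → (∀ a → f a ≡ g a) →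
               ∀ x → (f (proj₁ x) , f (proj₂ x)) ≡ (g (proj₁ x) , g (proj₂ x))
  pointwise₁ f≡g x = cong₂ _,_ (f≡g _) (f≡g _)

  pointwise₂ : ∀ {f g : ℤ → ℤ → ℤ} → (∀ a b → f a b ≡ g a b) →
               ∀ x y → (f (proj₁ x) (proj₁ y) , f (proj₂ x) (proj₂ y))
                     ≡ (g (proj₁ x) (proj₁ y) , g (proj₂ x) (proj₂ y))
  pointwise₂ f≡g x y = cong₂ _,_ (f≡g _ _) (f≡g _ _)

  pointwise₃ : ∀ {f g : ℤ → ℤ → ℤ → ℤ} → (∀ a b c → f a b c ≡ g a b c) →
               ∀ x y z → (f (proj₁ x) (proj₁ y) (proj₁ z) , f (proj₂ x) (proj₂ y) (proj₂ z))
                       ≡ (g (proj₁ x) (proj₁ y) (proj₁ z) , g (proj₂ x) (proj₂ y) (proj₂ z))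
  pointwise₃ f≡g x y z = cong₂ _,_ (f≡g _ _ _) (f≡g _ _ _)

  pointwise₄ : ∀ {f g : ℤ → ℤ → ℤ → ℤ → ℤ} → (∀ a b c d → f a b c d ≡ g a b c d) →
               ∀ x y z w → (f (proj₁ x) (proj₁ y) (proj₁ z) (proj₁ w) , f (proj₂ x) (proj₂ y) (proj₂ z) (proj₂ w))
                         ≡ (g (proj₁ x) (proj₁ y) (proj₁ z) (proj₁ w) , g (proj₂ x) (proj₂ y) (proj₂ z) (proj₂ w))
  pointwise₄ f≡g x y z w = cong₂ _,_ (f≡g _ _ _ _) (f≡g _ _ _ _)

⊕-identityˡ : ∀ x → 0ᶠ ⊕ x ≡ x
⊕-identityˡ = pointwise₁ solve-∀

⊕-identityʳ : ∀ x → x ⊕ 0ᶠ ≡ x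
⊕-identityʳ = pointwise₁ solve-∀

⊕-comm : ∀ x y → x ⊕ y ≡ y ⊕ x
⊕-comm = pointwise₂ solve-∀

⊕-⊝-inverse : ∀ x → x ⊕ ⊝ x ≡ 0ᶠ
⊕-⊝-inverse = pointwise₁ solve-∀

⊖-self : ∀ x → x ⊖ x ≡ 0ᶠ
⊖-self = pointwise₁ solve-∀

⊖-identityʳ : ∀ x → x ⊖ 0ᶠ ≡ x
⊖-identityʳ = pointwise₁ solve-∀

0⊖x≡⊝x : ∀ x → 0ᶠ ⊖ x ≡ ⊝ x
0⊖x≡⊝x = pointwise₁ solve-∀

⊝x⊕y≡y⊖x : ∀ x y → ⊝ x ⊕ y ≡ y ⊖ x
⊝x⊕y≡y⊖x = pointwise₂ solve-∀

x⊖⊝y≡x⊕y : ∀ x y → x ⊖ ⊝ y ≡ x ⊕ y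
x⊖⊝y≡x⊕y = pointwise₂ solve-∀

x⊕y⊖x≡y : ∀ x y → x ⊕ y ⊖ x ≡ y
x⊕y⊖x≡y = pointwise₂ solve-∀

x⊕y⊖y≡x : ∀ x y → x ⊕ y ⊖ y ≡ x
x⊕y⊖y≡x = pointwise₂ solve-∀

x⊖y⊕y≡x : ∀ x y → x ⊖ y ⊕ y ≡ x
x⊖y⊕y≡x = pointwise₂ solve-∀

x⊖[x⊖y]≡y : ∀ x y → x ⊖ (x ⊖ y) ≡ y
x⊖[x⊖y]≡y = pointwise₂ solve-∀

⊖-telescope : ∀ x y z → (z ⊖ y) ⊕ (y ⊖ x) ≡ z ⊖ x
⊖-telescope = pointwise₃ solve-∀

⊕-⊖-cancelʳ : ∀ x y z → (y ⊕ z) ⊖ (x ⊕ z) ≡ y ⊖ x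
⊕-⊖-cancelʳ = pointwise₃ solve-∀

⊖-⊖-cancelˡ : ∀ x y z → (z ⊖ x) ⊖ (z ⊖ y) ≡ y ⊖ x
⊖-⊖-cancelˡ = pointwise₃ solve-∀

⊕-⊖-interchange : ∀ x y u v → (y ⊕ v) ⊖ (x ⊕ u) ≡ (y ⊖ x) ⊕ (v ⊖ u)
⊕-⊖-interchange = pointwise₄ solve-∀

⊙-identityˡ : ∀ x → 1ℤ ⊙ x ≡ x
⊙-identityˡ = pointwise₁ solve-∀

-1⊙x≡⊝x : ∀ x → -1ℤ ⊙ x ≡ ⊝ x
-1⊙x≡⊝x = pointwise₁ solve-∀

⊙-sign⁺ : ∀ {σ} x → σ ≡ 1ℤ → σ ⊙ x ≡ x
⊙-sign⁺ x refl = ⊙-identityˡ x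

⊙-sign⁻ : ∀ {σ} x → σ ≡ -1ℤ → σ ⊙ x ≡ ⊝ x
⊙-sign⁻ x refl = -1⊙x≡⊝x x

⊙-zeroʳ : ∀ k → k ⊙ 0ᶠ ≡ 0ᶠ
⊙-zeroʳ k = cong₂ _,_ (ℤ.*-zeroʳ k) (ℤ.*-zeroʳ k)

⊙-involutive : ∀ σ → σ * σ ≡ 1ℤ → ∀ x → σ ⊙ (σ ⊙ x) ≡ x
⊙-involutive σ σσ≡1 x = cong₂ _,_ (cancel (proj₁ x)) (cancel (proj₂ x))
  where
  cancel : ∀ y → σ * (σ * y) ≡ y
  cancel y = trans (sym (ℤ.*-assoc σ σ y)) (trans (cong (_* y) σσ≡1) (ℤ.*-identityˡ y))

⊙-+-distribʳ : ∀ i j x → (i + j) ⊙ x ≡ i ⊙ x ⊕ j ⊙ x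
⊙-+-distribʳ i j x = cong₂ _,_ (distrib i j (proj₁ x)) (distrib i j (proj₂ x))
  where
  distrib : ∀ i j a → (i + j) * a ≡ i * a + j * a
  distrib = solve-∀

suc-⊙ : ∀ k x → (1ℤ + k) ⊙ x ≡ x ⊕ k ⊙ x
suc-⊙ k x = cong₂ _,_ (distrib k (proj₁ x)) (distrib k (proj₂ x))
  where
  distrib : ∀ k a → (1ℤ + k) * a ≡ a + k * a
  distrib = solve-∀

pred-⊙ : ∀ k x → (k - 1ℤ) ⊙ x ≡ k ⊙ x ⊖ x
pred-⊙ k x = cong₂ _,_ (distrib k (proj₁ x)) (distrib k (proj₂ x))
  where
  distrib : ∀ k a → (k - 1ℤ) * a ≡ k * a + - a
  distrib = solve-∀

⊖-pred-⊙ : ∀ k x t → x ⊖ (k - 1ℤ) ⊙ t ≡ (x ⊕ t) ⊖ k ⊙ t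
⊖-pred-⊙ k x t = cong₂ _,_ (distrib k (proj₁ x) (proj₁ t)) (distrib k (proj₂ x) (proj₂ t))
  where
  distrib : ∀ k a b → a + - ((k - 1ℤ) * b) ≡ a + b + - (k * b)
  distrib = solve-∀

⊕-suc-⊙ : ∀ k t u → k ⊙ t ⊕ u ⊕ t ≡ (1ℤ + k) ⊙ t ⊕ u
⊕-suc-⊙ k t u = cong₂ _,_ (distrib k (proj₁ t) (proj₁ u)) (distrib k (proj₂ t) (proj₂ u))
  where
  distrib : ∀ k a b → k * a + b + a ≡ (1ℤ + k) * a + b
  distrib = solve-∀

⊙-⊕-swap : ∀ σ k d h → σ ⊙ (k ⊙ d ⊕ h) ≡ k ⊙ (σ ⊙ d) ⊖ (- σ) ⊙ h
⊙-⊕-swap σ k d h = cong₂ _,_ (distrib σ k (proj₁ d) (proj₁ h)) (distrib σ k (proj₂ d) (proj₂ h))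
  where
  distrib : ∀ σ k a b → σ * (k * a + b) ≡ k * (σ * a) + - ((- σ) * b)
  distrib = solve-∀

-- A real θ, known through the positivity of forms, with numerators P k such
-- that T k = s k (q_k θ − P k) is positive for signs s k = ±1 that alternate.
-- The instances are θ = α and θ = −α.
record Convergents (a : ℕ → ℕ) : Set₁ where
  field
    Pos       : Form → Set
    pos-⊕     : ∀ {x y} → Pos x → Pos y → Pos (x ⊕ y)
    pos-one   : Pos 1ᶠ
    pos-const : ∀ {v} → Pos (0ℤ , v) → 0ℤ ℤ.< v
    P         : ℕ → ℤ
    P-rec     : ∀ k → P (suc (suc k)) ≡ + a (suc (suc k)) * P (suc k) + P k
    s         : ℕ → ℤ
    s-suc     : ∀ k → s (suc k) ≡ - s k
    s-unit    : ∀ k → IsUnit (s k)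
    det       : ∀ k → P (suc k) * + q a k - P k * + q a (suc k) ≡ s k
    T-pos     : ∀ k → Pos (s k ⊙ (+ q a k , - P k))

module ConvergentTheory {a : ℕ → ℕ} (a-pos : ∀ k → 1 ℕ.≤ a (suc k)) (C : Convergents a) where
  open Convergents C

  -- a record, so that x and y can be recovered from x <ᶠ y
  infix 4 _<ᶠ_
  record _<ᶠ_ (x y : Form) : Set where
    constructor <ᶠ-intro
    field difference-pos : Pos (y ⊖ x)
  open _<ᶠ_ public

  pos⇒0<ᶠ : ∀ {x} → Pos x → 0ᶠ <ᶠ x
  pos⇒0<ᶠ {x} p = <ᶠ-intro (subst Pos (sym (⊖-identityʳ x)) p)

  <ᶠ-trans : ∀ {x y z} → x <ᶠ y → y <ᶠ z → x <ᶠ z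
  <ᶠ-trans {x} {y} {z} (<ᶠ-intro x<y) (<ᶠ-intro y<z) = <ᶠ-intro (subst Pos (⊖-telescope x y z) (pos-⊕ y<z x<y))

  <ᶠ-irrefl : ∀ {x y} → x ≡ y → ¬ x <ᶠ y
  <ᶠ-irrefl {x} refl (<ᶠ-intro x<x) = ℤ.<-irrefl refl (pos-const (subst Pos (⊖-self x) x<x))

  <ᶠ-strictPartialOrder : StrictPartialOrder _ _ _
  <ᶠ-strictPartialOrder = record
    { isStrictPartialOrder = record
      { isEquivalence = isEquivalence
      ; irrefl        = <ᶠ-irrefl
      ; trans         = <ᶠ-trans
      ; <-resp-≈      = (λ { refl x<y → x<y }) , (λ { refl x<y → x<y })
      }
    }

  module <ᶠ-Reasoning = Relation.Binary.Reasoning.StrictPartialOrder <ᶠ-strictPartialOrder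
  open import Relation.Binary.Construct.StrictToNonStrict _≡_ _<ᶠ_ public
    using () renaming (_≤_ to _≤ᶠ_)

  <ᶠ-≤ᶠ-trans : ∀ {x y z} → x <ᶠ y → y ≤ᶠ z → x <ᶠ z
  <ᶠ-≤ᶠ-trans x<y (inj₁ y<z)  = <ᶠ-trans x<y y<z
  <ᶠ-≤ᶠ-trans x<y (inj₂ refl) = x<y

  private
    via : ∀ {x y u v} → u ⊖ x ≡ v ⊖ y → x <ᶠ u → y <ᶠ v
    via e (<ᶠ-intro p) = <ᶠ-intro (subst Pos e p)

  +-mono-<ᶠ : ∀ {x y u v} → x <ᶠ y → u <ᶠ v → x ⊕ u <ᶠ y ⊕ v
  +-mono-<ᶠ {x} {y} {u} {v} (<ᶠ-intro x<y) (<ᶠ-intro u<v) =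
    <ᶠ-intro (subst Pos (sym (⊕-⊖-interchange x y u v)) (pos-⊕ x<y u<v))

  +-monoˡ-<ᶠ : ∀ {x y} z → x <ᶠ y → x ⊕ z <ᶠ y ⊕ z
  +-monoˡ-<ᶠ {x} {y} z = via (sym (⊕-⊖-cancelʳ x y z))

  ⊖-monoʳ-<ᶠ : ∀ {x y} z → x <ᶠ y → z ⊖ y <ᶠ z ⊖ x
  ⊖-monoʳ-<ᶠ {x} {y} z = via (sym (⊖-⊖-cancelˡ x y z))

  x<ᶠx⊕y : ∀ x {y} → 0ᶠ <ᶠ y → x <ᶠ x ⊕ y
  x<ᶠx⊕y x {y} = via (trans (⊖-identityʳ y) (sym (x⊕y⊖x≡y x y)))

  x⊖y<ᶠx : ∀ x {y} → 0ᶠ <ᶠ y → x ⊖ y <ᶠ x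
  x⊖y<ᶠx x {y} = via (trans (⊖-identityʳ y) (sym (x⊖[x⊖y]≡y x y)))

  <ᶠ⇒0<ᶠ⊖ : ∀ {x y} → x <ᶠ y → 0ᶠ <ᶠ y ⊖ x
  <ᶠ⇒0<ᶠ⊖ {x} {y} = via (sym (⊖-identityʳ (y ⊖ x)))

  0<ᶠ⊖⇒<ᶠ : ∀ {x y} → 0ᶠ <ᶠ y ⊖ x → x <ᶠ y
  0<ᶠ⊖⇒<ᶠ {x} {y} = via (⊖-identityʳ (y ⊖ x))

  0≤ᶠ⇒¬0<ᶠ⊝ : ∀ {x} → 0ᶠ ≤ᶠ x → ¬ 0ᶠ <ᶠ ⊝ x
  0≤ᶠ⇒¬0<ᶠ⊝ {x} (inj₁ 0<x)  0<-x = <ᶠ-irrefl (sym (⊕-⊝-inverse x)) (+-mono-<ᶠ 0<x 0<-x)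
  0≤ᶠ⇒¬0<ᶠ⊝     (inj₂ refl) 0<-0 = <ᶠ-irrefl refl 0<-0

  0≤ᶠ⊖⇒≤ᶠ : ∀ {x y} → 0ᶠ ≤ᶠ y ⊖ x → x ≤ᶠ y
  0≤ᶠ⊖⇒≤ᶠ (inj₁ 0<y-x) = inj₁ (0<ᶠ⊖⇒<ᶠ 0<y-x)
  0≤ᶠ⊖⇒≤ᶠ {x} {y} (inj₂ 0≡y-x) = inj₂ (trans (sym (⊕-identityˡ x)) (trans (cong (_⊕ x) 0≡y-x) (x⊖y⊕y≡x y x)))

  +-monoˡ-≤ᶠ : ∀ {x y} z → x ≤ᶠ y → x ⊕ z ≤ᶠ y ⊕ z
  +-monoˡ-≤ᶠ z (inj₁ x<y)  = inj₁ (+-monoˡ-<ᶠ z x<y)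
  +-monoˡ-≤ᶠ z (inj₂ refl) = inj₂ refl

  ⊖-monoʳ-≤ᶠ : ∀ {x y} z → x ≤ᶠ y → z ⊖ y ≤ᶠ z ⊖ x
  ⊖-monoʳ-≤ᶠ z (inj₁ x<y)  = inj₁ (⊖-monoʳ-<ᶠ z x<y)
  ⊖-monoʳ-≤ᶠ z (inj₂ refl) = inj₂ refl

  x≤ᶠx⊕y : ∀ x {y} → 0ᶠ ≤ᶠ y → x ≤ᶠ x ⊕ y
  x≤ᶠx⊕y x (inj₁ 0<y)  = inj₁ (x<ᶠx⊕y x 0<y)
  x≤ᶠx⊕y x (inj₂ refl) = inj₂ (sym (⊕-identityʳ x))

  x⊖y≤ᶠx : ∀ x {y} → 0ᶠ ≤ᶠ y → x ⊖ y ≤ᶠ x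
  x⊖y≤ᶠx x (inj₁ 0<y)  = inj₁ (x⊖y<ᶠx x 0<y)
  x⊖y≤ᶠx x (inj₂ refl) = inj₂ (⊖-identityʳ x)

  0≤ᶠ-⊕ : ∀ {x y} → 0ᶠ ≤ᶠ x → 0ᶠ ≤ᶠ y → 0ᶠ ≤ᶠ x ⊕ y
  0≤ᶠ-⊕ (inj₁ 0<x)  (inj₁ 0<y)  = inj₁ (+-mono-<ᶠ 0<x 0<y)
  0≤ᶠ-⊕ (inj₁ 0<x)  (inj₂ refl) = inj₁ (subst (0ᶠ <ᶠ_) (sym (⊕-identityʳ _)) 0<x)
  0≤ᶠ-⊕ (inj₂ refl) 0≤y         = subst (0ᶠ ≤ᶠ_) (sym (⊕-identityˡ _)) 0≤y

  0<ᶠ-⊙ : ∀ k {t} → 0ᶠ <ᶠ t → 0ᶠ <ᶠ + suc k ⊙ t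
  0<ᶠ-⊙ zero    {t} 0<t = subst (0ᶠ <ᶠ_) (sym (⊙-identityˡ t)) 0<t
  0<ᶠ-⊙ (suc k) {t} 0<t = subst (0ᶠ <ᶠ_) (sym (suc-⊙ (+ suc k) t)) (+-mono-<ᶠ 0<t (0<ᶠ-⊙ k 0<t))

  0≤ᶠ-⊙ : ∀ k {t} → 0ᶠ <ᶠ t → 0ᶠ ≤ᶠ + k ⊙ t
  0≤ᶠ-⊙ zero    0<t = inj₂ refl
  0≤ᶠ-⊙ (suc k) 0<t = inj₁ (0<ᶠ-⊙ k 0<t)

  ⊙-monoˡ-≤ᶠ : ∀ {i j t} → i ℕ.≤ j → 0ᶠ <ᶠ t → + i ⊙ t ≤ᶠ + j ⊙ t
  ⊙-monoˡ-≤ᶠ {i} {j} {t} i≤j 0<t = begin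
    + i ⊙ t                   ≤⟨ x≤ᶠx⊕y (+ i ⊙ t) (0≤ᶠ-⊙ (j ℕ.∸ i) 0<t) ⟩
    + i ⊙ t ⊕ + (j ℕ.∸ i) ⊙ t ≡⟨ ⊙-+-distribʳ (+ i) (+ (j ℕ.∸ i)) t ⟨
    (+ i + + (j ℕ.∸ i)) ⊙ t   ≡⟨ cong (_⊙ t) (trans (sym (ℤ.pos-+ i (j ℕ.∸ i))) (cong +_ (ℕ.m+[n∸m]≡n i≤j))) ⟩
    + j ⊙ t                   ∎
    where open <ᶠ-Reasoning

  0≤ᶠ-const : ∀ w → 0ℤ ℤ.< 1ℤ + w → 0ᶠ ≤ᶠ (0ℤ , w)
  0≤ᶠ-const (+ zero)  _     = inj₂ refl
  0≤ᶠ-const +[1+ k ]  _     = inj₁ (subst (0ᶠ <ᶠ_) (cong₂ _,_ (ℤ.*-zeroʳ +[1+ k ]) (ℤ.*-identityʳ +[1+ k ]))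
                                          (0<ᶠ-⊙ k (pos⇒0<ᶠ pos-one)))
  0≤ᶠ-const -[1+ k ] 0<1-k = ⊥-elim (ℤ.<⇒≱ 0<1-k (1+[-1-k]≤0 k))
    where
    1+[-1-k]≤0 : ∀ k → 1ℤ + -[1+ k ] ℤ.≤ 0ℤ
    1+[-1-k]≤0 zero    = ℤ.+≤+ ℕ.z≤n
    1+[-1-k]≤0 (suc k) = ℤ.-≤+

  D : ℕ → Form
  D k = (+ q a k , - P k)

  T : ℕ → Form
  T k = s k ⊙ D k

  0<T : ∀ k → 0ᶠ <ᶠ T k
  0<T k = pos⇒0<ᶠ (T-pos k)

  s*s≡1 : ∀ k → s k * s k ≡ 1ℤ
  s*s≡1 k = unit*unit≡1 (s-unit k)

  s-suc≢ : ∀ k → s (suc k) ≢ s k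
  s-suc≢ k s′≡s with s-unit k
  ... | inj₁ s≡1  = 1≢-1 (trans (sym s≡1) (trans (sym s′≡s) (trans (s-suc k) (cong -_ s≡1))))
  ... | inj₂ s≡-1 = 1≢-1 (sym (trans (sym s≡-1) (trans (sym s′≡s) (trans (s-suc k) (cong -_ s≡-1)))))

  D≡s⊙T : ∀ k → D k ≡ s k ⊙ T k
  D≡s⊙T k = sym (⊙-involutive (s k) (s*s≡1 k) (D k))

  D≡T : ∀ {k} → s k ≡ 1ℤ → D k ≡ T k
  D≡T {k} sk≡1 = trans (D≡s⊙T k) (⊙-sign⁺ (T k) sk≡1)

  D≡⊝T : ∀ {k} → s k ≡ -1ℤ → D k ≡ ⊝ T k
  D≡⊝T {k} sk≡-1 = trans (D≡s⊙T k) (⊙-sign⁻ (T k) sk≡-1)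

  D-rec : ∀ k → D (suc (suc k)) ≡ + a (suc (suc k)) ⊙ D (suc k) ⊕ D k
  D-rec k = cong₂ _,_ (+q-rec a k) (trans (cong -_ (P-rec k)) (neg-distrib (+ a (suc (suc k))) (P (suc k)) (P k)))
    where
    neg-distrib : ∀ A x y → - (A * x + y) ≡ A * - x + - y
    neg-distrib = solve-∀

  T-rec : ∀ k → T k ≡ + a (suc (suc k)) ⊙ T (suc k) ⊕ T (suc (suc k))
  T-rec k = begin
    s k ⊙ D k                                       ≡⟨ cong₂ _,_ (regroup (s k) A _ _) (regroup (s k) A _ _) ⟩
    A ⊙ ((- s k) ⊙ D (suc k)) ⊕ (- - s k) ⊙ (A ⊙ D (suc k) ⊕ D k)
      ≡⟨ cong₂ (λ σ σ′ → A ⊙ (σ ⊙ D (suc k)) ⊕ σ′ ⊙ (A ⊙ D (suc k) ⊕ D k))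
               (sym (s-suc k)) (sym (trans (s-suc (suc k)) (cong -_ (s-suc k)))) ⟩
    A ⊙ T (suc k) ⊕ s (suc (suc k)) ⊙ (A ⊙ D (suc k) ⊕ D k)
                                                    ≡⟨ cong (λ d → A ⊙ T (suc k) ⊕ s (suc (suc k)) ⊙ d) (D-rec k) ⟨
    A ⊙ T (suc k) ⊕ T (suc (suc k))                 ∎
    where
    open ≡-Reasoning
    A : ℤ
    A = + a (suc (suc k))
    regroup : ∀ σ A x y → σ * y ≡ A * ((- σ) * x) + (- - σ) * (A * x + y)
    regroup = solve-∀

  T⊕T≤T : ∀ k → T (suc k) ⊕ T (suc (suc k)) ≤ᶠ T k
  T⊕T≤T k = begin
    T (suc k) ⊕ T (suc (suc k))                     ≡⟨ cong (_⊕ T (suc (suc k))) (⊙-identityˡ (T (suc k))) ⟨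
    + 1 ⊙ T (suc k) ⊕ T (suc (suc k))
      ≤⟨ +-monoˡ-≤ᶠ (T (suc (suc k))) (⊙-monoˡ-≤ᶠ (a-pos (suc k)) (0<T (suc k))) ⟩
    + a (suc (suc k)) ⊙ T (suc k) ⊕ T (suc (suc k)) ≡⟨ T-rec k ⟨
    T k                                             ∎
    where open <ᶠ-Reasoning

  T-dec : ∀ k → T (suc k) <ᶠ T k
  T-dec k = <ᶠ-≤ᶠ-trans (x<ᶠx⊕y (T (suc k)) (0<T (suc (suc k)))) (T⊕T≤T k)

  T-anti : ∀ {i j} → i ℕ.≤ j → T j ≤ᶠ T i
  T-anti {i} {j} i≤j with ℕ.m≤n⇒m<n∨m≡n i≤j
  ... | inj₂ refl = inj₂ refl
  ... | inj₁ (ℕ.s≤s i≤j′) = inj₁ (begin-strict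
    T _ <⟨ T-dec _ ⟩
    T _ ≤⟨ T-anti i≤j′ ⟩
    T i ∎)
    where open <ᶠ-Reasoning

  -- Best approximation

  private
    q≤combination : ∀ k x y → q a (suc k) ℕ.≤ suc x ℕ.* q a k ℕ.+ suc y ℕ.* q a (suc k)
    q≤combination k x y = ℕ.≤-trans (ℕ.m≤m+n (q a (suc k)) (y ℕ.* q a (suc k))) (ℕ.m≤n+m _ (suc x ℕ.* q a k))

    pos-combination : ∀ a b c d → + (a ℕ.* b ℕ.+ c ℕ.* d) ≡ + a * + b + + c * + d
    pos-combination a b c d = trans (ℤ.pos-+ (a ℕ.* b) (c ℕ.* d)) (cong₂ _+_ (ℤ.pos-* a b) (ℤ.pos-* c d))

    ¬0<negative-combination : ∀ k i j → ¬ 0ᶠ <ᶠ (- + i) ⊙ T k ⊕ (- + j) ⊙ T (suc k)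
    ¬0<negative-combination k i j 0<form =
      0≤ᶠ⇒¬0<ᶠ⊝ (0≤ᶠ-⊕ (0≤ᶠ-⊙ i (0<T k)) (0≤ᶠ-⊙ j (0<T (suc k))))
                (subst (0ᶠ <ᶠ_) (negate (+ i) (+ j) (T k) (T (suc k))) 0<form)
      where
      negate : ∀ i j t u → (- i) ⊙ t ⊕ (- j) ⊙ u ≡ ⊝ (i ⊙ t ⊕ j ⊙ u)
      negate i j t u = cong₂ _,_ (ring i j (proj₁ t) (proj₁ u)) (ring i j (proj₂ t) (proj₂ u))
        where
        ring : ∀ i j a b → (- i) * a + (- j) * b ≡ - (i * a + j * b)
        ring = solve-∀

  coordinate₀ coordinate₁ : ℕ → ℤ → ℤ → ℤ
  coordinate₀ k E C = E * P (suc k) + C * + q a (suc k)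
  coordinate₁ k E C = E * P k + C * + q a k

  -- det k = s k makes T k, T (k + 1) a basis of the forms.
  basis-decomposition : ∀ k E C → (E , C) ≡ coordinate₀ k E C ⊙ T k ⊕ coordinate₁ k E C ⊙ T (suc k)
  basis-decomposition k E C = begin
    (E , C)                                        ≡⟨ cong₂ _,_ (σ-twice E) (σ-twice C) ⟨
    (σ * E * σ , σ * C * σ)                        ≡⟨ cong (λ d → (σ * E * d , σ * C * d)) (det k) ⟨
    (σ * E * d , σ * C * d)
      ≡⟨ cong₂ _,_ (first σ E C (P k) (P (suc k)) (+ q a k) (+ q a (suc k)))
                   (second σ E C (P k) (P (suc k)) (+ q a k) (+ q a (suc k))) ⟨
    X ⊙ (σ ⊙ D k) ⊕ Y ⊙ ((- σ) ⊙ D (suc k))        ≡⟨ cong (λ σ′ → X ⊙ T k ⊕ Y ⊙ (σ′ ⊙ D (suc k))) (s-suc k) ⟨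
    X ⊙ T k ⊕ Y ⊙ T (suc k)                        ∎
    where
    open ≡-Reasoning
    σ : ℤ
    σ = s k
    X : ℤ
    X = coordinate₀ k E C
    Y : ℤ
    Y = coordinate₁ k E C
    d : ℤ
    d = P (suc k) * + q a k - P k * + q a (suc k)
    σ-twice : ∀ Z → σ * Z * σ ≡ Z
    σ-twice Z = trans (ring σ Z) (trans (cong (_* Z) (s*s≡1 k)) (ℤ.*-identityˡ Z))
      where
      ring : ∀ σ Z → σ * Z * σ ≡ σ * σ * Z
      ring = solve-∀
    first : ∀ σ E C P P′ q₀ q₁ →
      (E * P′ + C * q₁) * (σ * q₀) + (E * P + C * q₀) * ((- σ) * q₁) ≡ σ * E * (P′ * q₀ - P * q₁)
    first = solve-∀
    second : ∀ σ E C P P′ q₀ q₁ →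
      (E * P′ + C * q₁) * (σ * - P) + (E * P + C * q₀) * ((- σ) * - P′) ≡ σ * C * (P′ * q₀ - P * q₁)
    second = solve-∀

  s*E≡coordinates : ∀ k E C → s k * E ≡ coordinate₀ k E C * + q a k - coordinate₁ k E C * + q a (suc k)
  s*E≡coordinates k E C = trans (ℤ.*-comm (s k) E) (trans (cong (E *_) (sym (det k)))
                                (sym (ring E C (P k) (P (suc k)) (+ q a k) (+ q a (suc k)))))
    where
    ring : ∀ E C P P′ q₀ q₁ → (E * P′ + C * q₁) * q₀ - (E * P + C * q₀) * q₁ ≡ E * (P′ * q₀ - P * q₁)
    ring = solve-∀

  natural-coordinates : ∀ k X Y → 0ᶠ <ᶠ X ⊙ T k ⊕ Y ⊙ T (suc k) →
                        X * + q a k - Y * + q a (suc k) ≢ 0ℤ →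
                        - + q a (suc k) ℤ.< X * + q a k - Y * + q a (suc k) →
                        X * + q a k - Y * + q a (suc k) ℤ.< + q a (suc k) →
                        Σ ℕ λ x → Σ ℕ λ y → X ≡ +[1+ x ] × Y ≡ + y
  natural-coordinates k +[1+ x ] (+ y)    _ _ _ _ = x , y , refl , refl
  natural-coordinates k (+ zero) (+ zero) _ Z≢0 _ _ = ⊥-elim (Z≢0 (ring (+ q a k) (+ q a (suc k))))
    where
    ring : ∀ a b → 0ℤ * a - 0ℤ * b ≡ 0ℤ
    ring = solve-∀
  natural-coordinates k (+ zero) +[1+ y ] _ _ -q₁<Z _ = ⊥-elim (<-neg⇒≢ (ℕ.m≤m+n _ _) -q₁<Z
    (trans (ring +[1+ y ] (+ q a (suc k)) (+ q a k)) (cong -_ (sym (ℤ.pos-* (suc y) (q a (suc k)))))))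
    where
    ring : ∀ b c a → 0ℤ * a - b * c ≡ - (b * c)
    ring = solve-∀
  natural-coordinates k (+ zero) -[1+ y ] _ _ _ Z<q₁ = ⊥-elim (<-pos⇒≢ (ℕ.m≤m+n _ _) Z<q₁
    (trans (ring +[1+ y ] (+ q a (suc k)) (+ q a k)) (sym (ℤ.pos-* (suc y) (q a (suc k))))))
    where
    ring : ∀ b c a → 0ℤ * a - (- b) * c ≡ b * c
    ring = solve-∀
  natural-coordinates k +[1+ x ] -[1+ y ] _ _ _ Z<q₁ = ⊥-elim (<-pos⇒≢ (q≤combination k x y) Z<q₁
    (trans (ring +[1+ x ] +[1+ y ] (+ q a k) (+ q a (suc k)))
           (sym (pos-combination (suc x) (q a k) (suc y) (q a (suc k))))))
    where
    ring : ∀ a b c d → a * c - (- b) * d ≡ a * c + b * d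
    ring = solve-∀
  natural-coordinates k -[1+ x ] +[1+ y ] _ _ -q₁<Z _ = ⊥-elim (<-neg⇒≢ (q≤combination k x y) -q₁<Z
    (trans (ring +[1+ x ] +[1+ y ] (+ q a k) (+ q a (suc k)))
           (cong -_ (sym (pos-combination (suc x) (q a k) (suc y) (q a (suc k)))))))
    where
    ring : ∀ a b c d → (- a) * c - b * d ≡ - (a * c + b * d)
    ring = solve-∀
  natural-coordinates k -[1+ x ] (+ zero) 0<form _ _ _ = ⊥-elim (¬0<negative-combination k (suc x) 0 0<form)
  natural-coordinates k -[1+ x ] -[1+ y ] 0<form _ _ _ = ⊥-elim (¬0<negative-combination k (suc x) (suc y) 0<form)

  natural-combination-bounds : ∀ k x y →
    T k ≤ᶠ +[1+ x ] ⊙ T k ⊕ + y ⊙ T (suc k) ×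
    (0 ℕ.< x ℕ.+ y → T k ⊕ T (suc k) ≤ᶠ +[1+ x ] ⊙ T k ⊕ + y ⊙ T (suc k))
  natural-combination-bounds k x y = lower , lower′ x y
    where
    open <ᶠ-Reasoning
    t : Form
    t = T k
    u : Form
    u = T (suc k)
    lower : t ≤ᶠ +[1+ x ] ⊙ t ⊕ + y ⊙ u
    lower = begin
      t                       ≤⟨ x≤ᶠx⊕y t (0≤ᶠ-⊕ (0≤ᶠ-⊙ x (0<T k)) (0≤ᶠ-⊙ y (0<T (suc k)))) ⟩
      t ⊕ (+ x ⊙ t ⊕ + y ⊙ u) ≡⟨ regroup (+ x) (+ y) t u ⟨
      +[1+ x ] ⊙ t ⊕ + y ⊙ u  ∎
      where
      regroup : ∀ i j t u → (1ℤ + i) ⊙ t ⊕ j ⊙ u ≡ t ⊕ (i ⊙ t ⊕ j ⊙ u)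
      regroup i j t u = cong₂ _,_ (ring i j (proj₁ t) (proj₁ u)) (ring i j (proj₂ t) (proj₂ u))
        where
        ring : ∀ i j a b → (1ℤ + i) * a + j * b ≡ a + (i * a + j * b)
        ring = solve-∀
    lower′ : ∀ x y → 0 ℕ.< x ℕ.+ y → t ⊕ u ≤ᶠ +[1+ x ] ⊙ t ⊕ + y ⊙ u
    lower′ x (suc y) _ = begin
      t ⊕ u                         ≤⟨ x≤ᶠx⊕y (t ⊕ u) (0≤ᶠ-⊕ (0≤ᶠ-⊙ x (0<T k)) (0≤ᶠ-⊙ y (0<T (suc k)))) ⟩
      (t ⊕ u) ⊕ (+ x ⊙ t ⊕ + y ⊙ u) ≡⟨ regroup (+ x) (+ y) t u ⟨
      +[1+ x ] ⊙ t ⊕ +[1+ y ] ⊙ u   ∎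
      where
      regroup : ∀ i j t u → (1ℤ + i) ⊙ t ⊕ (1ℤ + j) ⊙ u ≡ (t ⊕ u) ⊕ (i ⊙ t ⊕ j ⊙ u)
      regroup i j t u = cong₂ _,_ (ring i j (proj₁ t) (proj₁ u)) (ring i j (proj₂ t) (proj₂ u))
        where
        ring : ∀ i j a b → (1ℤ + i) * a + (1ℤ + j) * b ≡ (a + b) + (i * a + j * b)
        ring = solve-∀
    lower′ (suc x) zero _ = begin
      t ⊕ u                         ≤⟨ x≤ᶠx⊕y (t ⊕ u) (0≤ᶠ-⊕ (0≤ᶠ-⊙ x (0<T k)) (inj₁ (<ᶠ⇒0<ᶠ⊖ (T-dec k)))) ⟩
      (t ⊕ u) ⊕ (+ x ⊙ t ⊕ (t ⊖ u)) ≡⟨ regroup (+ x) t u ⟨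
      +[1+ suc x ] ⊙ t ⊕ + 0 ⊙ u    ∎
      where
      regroup : ∀ i t u → (1ℤ + (1ℤ + i)) ⊙ t ⊕ 0ℤ ⊙ u ≡ (t ⊕ u) ⊕ (i ⊙ t ⊕ (t ⊖ u))
      regroup i t u = cong₂ _,_ (ring i (proj₁ t) (proj₁ u)) (ring i (proj₂ t) (proj₂ u))
        where
        ring : ∀ i a b → (1ℤ + (1ℤ + i)) * a + 0ℤ * b ≡ (a + b) + (i * a + (a + - b))
        ring = solve-∀

  best-approximation : ∀ k {E C} → E ≢ 0ℤ → - + q a (suc k) ℤ.< E → E ℤ.< + q a (suc k) →
                       0ᶠ <ᶠ (E , C) →
                       T k ≤ᶠ (E , C) × (E ≢ s k * + q a k → T k ⊕ T (suc k) ≤ᶠ (E , C))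
  best-approximation k {E} {C} E≢0 -q₁<E E<q₁ 0<EC =
    conclude (natural-coordinates k X Y (subst (0ᶠ <ᶠ_) (basis-decomposition k E C) 0<EC)
                                  (λ Z≡0 → E≢0 (σ-injective (trans σE≡Z (trans Z≡0 (sym (ℤ.*-zeroʳ σ))))))
                                  (subst (- q₁ ℤ.<_) σE≡Z (proj₁ σE-bounds)) (subst (ℤ._< q₁) σE≡Z (proj₂ σE-bounds)))
    where
    σ : ℤ
    σ = s k
    q₀ : ℤ
    q₀ = + q a k
    q₁ : ℤ
    q₁ = + q a (suc k)
    X : ℤ
    X = coordinate₀ k E C
    Y : ℤ
    Y = coordinate₁ k E C
    σE≡Z : σ * E ≡ X * q₀ - Y * q₁
    σE≡Z = s*E≡coordinates k E C

    σ-twice : ∀ i → σ * (σ * i) ≡ i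
    σ-twice i = trans (sym (ℤ.*-assoc σ σ i)) (trans (cong (_* i) (s*s≡1 k)) (ℤ.*-identityˡ i))

    σ-injective : ∀ {i j} → σ * i ≡ σ * j → i ≡ j
    σ-injective {i} {j} σi≡σj = trans (sym (σ-twice i)) (trans (cong (σ *_) σi≡σj) (σ-twice j))

    σE-bounds : - q₁ ℤ.< σ * E × σ * E ℤ.< q₁
    σE-bounds with s-unit k
    ... | inj₁ σ≡1  rewrite σ≡1  = subst (λ e → - q₁ ℤ.< e × e ℤ.< q₁) (sym (ℤ.*-identityˡ E)) (-q₁<E , E<q₁)
    ... | inj₂ σ≡-1 rewrite σ≡-1 = subst (λ e → - q₁ ℤ.< e × e ℤ.< q₁) (sym (ℤ.-1*i≡-i E))
                                     (ℤ.neg-mono-< E<q₁ , subst (- E ℤ.<_) (ℤ.neg-involutive q₁) (ℤ.neg-mono-< -q₁<E))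

    conclude : (Σ ℕ λ x → Σ ℕ λ y → X ≡ +[1+ x ] × Y ≡ + y) →
               T k ≤ᶠ (E , C) × (E ≢ σ * q₀ → T k ⊕ T (suc k) ≤ᶠ (E , C))
    conclude (x , y , X≡ , Y≡) =
      subst (T k ≤ᶠ_) (sym EC≡) (proj₁ (natural-combination-bounds k x y)) ,
      λ E≢σq₀ → subst (T k ⊕ T (suc k) ≤ᶠ_) (sym EC≡)
                      (proj₂ (natural-combination-bounds k x y) (0<x+y x y X≡ Y≡ E≢σq₀))
      where
      EC≡ : (E , C) ≡ +[1+ x ] ⊙ T k ⊕ + y ⊙ T (suc k)
      EC≡ = trans (basis-decomposition k E C) (cong₂ (λ X′ Y′ → X′ ⊙ T k ⊕ Y′ ⊙ T (suc k)) X≡ Y≡)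
      0<x+y : ∀ x y → X ≡ +[1+ x ] → Y ≡ + y → E ≢ σ * q₀ → 0 ℕ.< x ℕ.+ y
      0<x+y (suc x) y       _  _  _     = ℕ.s≤s ℕ.z≤n
      0<x+y zero    (suc y) _  _  _     = ℕ.s≤s ℕ.z≤n
      0<x+y zero    zero    X≡ Y≡ E≢σq₀ = ⊥-elim (E≢σq₀ (σ-injective (trans σE≡q₀ (sym (σ-twice q₀)))))
        where
        σE≡q₀ : σ * E ≡ q₀
        σE≡q₀ = trans σE≡Z (trans (cong₂ (λ X′ Y′ → X′ * q₀ - Y′ * q₁) X≡ Y≡) (ring q₀ q₁))
          where
          ring : ∀ a b → 1ℤ * a - 0ℤ * b ≡ a
          ring = solve-∀

  tailForm : (ℕ → ℕ) → ℕ → ℕ → Form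
  tailForm b K zero    = 0ᶠ
  tailForm b K (suc R) = + b K ⊙ D K ⊕ tailForm b (suc K) R

  proj₁-tailForm : ∀ b K R → proj₁ (tailForm b K R) ≡ + sumFrom (λ k → b k ℕ.* q a k) K R
  proj₁-tailForm b K zero    = refl
  proj₁-tailForm b K (suc R) = trans (cong₂ _+_ (sym (ℤ.pos-* (b K) (q a K))) (proj₁-tailForm b (suc K) R))
                                     (sym (ℤ.pos-+ (b K ℕ.* q a K) _))

  tail-bounds : ∀ {b} → (∀ k → b (suc k) ℕ.≤ a (suc (suc k))) → ∀ {top} → (∀ k → top ℕ.< k → b k ≡ 0) →
                ∀ R K → top ℕ.< K ℕ.+ R →
                (+ b K - 1ℤ) ⊙ T K <ᶠ s K ⊙ tailForm b K R × s K ⊙ tailForm b K R <ᶠ + b K ⊙ T K ⊕ T (suc K)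
  tail-bounds {b} digit≤ {top} digit-vanishes zero K top<K
    rewrite digit-vanishes K (subst (top ℕ.<_) (ℕ.+-identityʳ K) top<K) =
    (begin-strict
      -1ℤ ⊙ T K      ≡⟨ trans (-1⊙x≡⊝x (T K)) (sym (0⊖x≡⊝x (T K))) ⟩
      0ᶠ ⊖ T K       <⟨ x⊖y<ᶠx 0ᶠ (0<T K) ⟩
      0ᶠ             ≡⟨ ⊙-zeroʳ (s K) ⟨
      s K ⊙ 0ᶠ       ∎) ,
    (begin-strict
      s K ⊙ 0ᶠ       ≡⟨ ⊙-zeroʳ (s K) ⟩
      0ᶠ             <⟨ 0<T (suc K) ⟩
      T (suc K)      ≡⟨ ⊕-identityˡ (T (suc K)) ⟨
      0ᶠ ⊕ T (suc K) ∎)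
    where open <ᶠ-Reasoning
  tail-bounds {b} digit≤ {top} digit-vanishes (suc R) K top<K+1+R = lower , upper
    where
    open <ᶠ-Reasoning
    β : ℤ
    β  = + b K
    β′ : ℤ
    β′ = + b (suc K)
    y : Form
    y  = s (suc K) ⊙ tailForm b (suc K) R
    IH : (β′ - 1ℤ) ⊙ T (suc K) <ᶠ y × y <ᶠ β′ ⊙ T (suc K) ⊕ T (suc (suc K))
    IH = tail-bounds digit≤ digit-vanishes R (suc K) (subst (top ℕ.<_) (ℕ.+-suc K R) top<K+1+R)

    unfold : s K ⊙ tailForm b K (suc R) ≡ β ⊙ T K ⊖ y
    unfold = trans (⊙-⊕-swap (s K) β (D K) (tailForm b (suc K) R))
                   (cong (λ σ → β ⊙ T K ⊖ σ ⊙ tailForm b (suc K) R) (sym (s-suc K)))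

    lower : (β - 1ℤ) ⊙ T K <ᶠ s K ⊙ tailForm b K (suc R)
    lower = begin-strict
      (β - 1ℤ) ⊙ T K                               ≡⟨ pred-⊙ β (T K) ⟩
      β ⊙ T K ⊖ T K                                ≡⟨ cong (β ⊙ T K ⊖_) (T-rec K) ⟩
      β ⊙ T K ⊖ (+ a (suc (suc K)) ⊙ T (suc K) ⊕ T (suc (suc K)))
                                                   ≤⟨ ⊖-monoʳ-≤ᶠ (β ⊙ T K) (+-monoˡ-≤ᶠ (T (suc (suc K)))
                                                        (⊙-monoˡ-≤ᶠ (digit≤ K) (0<T (suc K)))) ⟩
      β ⊙ T K ⊖ (β′ ⊙ T (suc K) ⊕ T (suc (suc K))) <⟨ ⊖-monoʳ-<ᶠ (β ⊙ T K) (proj₂ IH) ⟩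
      β ⊙ T K ⊖ y                                  ≡⟨ unfold ⟨
      s K ⊙ tailForm b K (suc R)                   ∎

    upper : s K ⊙ tailForm b K (suc R) <ᶠ β ⊙ T K ⊕ T (suc K)
    upper = begin-strict
      s K ⊙ tailForm b K (suc R)             ≡⟨ unfold ⟩
      β ⊙ T K ⊖ y                            <⟨ ⊖-monoʳ-<ᶠ (β ⊙ T K) (proj₁ IH) ⟩
      β ⊙ T K ⊖ (β′ - 1ℤ) ⊙ T (suc K)        ≡⟨ ⊖-pred-⊙ β′ (β ⊙ T K) (T (suc K)) ⟩
      (β ⊙ T K ⊕ T (suc K)) ⊖ β′ ⊙ T (suc K) ≤⟨ x⊖y≤ᶠx _ (0≤ᶠ-⊙ (b (suc K)) (0<T (suc K))) ⟩
      β ⊙ T K ⊕ T (suc K)                    ∎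

  -- Fractional parts

  IsFloorθ : ℤ → ℤ → Set
  IsFloorθ x c = 0ᶠ ≤ᶠ (x , - c) × (x , - c) <ᶠ 1ᶠ

  FracLtθ : ℤ → ℤ → Set
  FracLtθ x y = Σ ℤ λ cx → Σ ℤ λ cy → IsFloorθ x cx × IsFloorθ y cy × (x , - cx) <ᶠ (y , - cy)

  frac≤ : ∀ {v x c} → 0ᶠ <ᶠ v → proj₁ v ≡ x → (x , - c) <ᶠ 1ᶠ → (x , - c) ≤ᶠ v
  frac≤ {v} {x} {c} 0<v v₁≡x frac<1 =
    0≤ᶠ⊖⇒≤ᶠ (subst (0ᶠ ≤ᶠ_) (sym v-frac) (0≤ᶠ-const (proj₂ v + c) 0<1+v₂+c))
    where
    v-frac : v ⊖ (x , - c) ≡ (0ℤ , proj₂ v + c)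
    v-frac = cong₂ _,_ (trans (cong (_- x) v₁≡x) (ℤ.+-inverseʳ x)) (cong (λ w → proj₂ v + w) (ℤ.neg-involutive c))
    0<1+v₂+c : 0ℤ ℤ.< 1ℤ + (proj₂ v + c)
    0<1+v₂+c = pos-const (subst Pos (cong₂ _,_ first second) (difference-pos (+-mono-<ᶠ 0<v frac<1)))
      where
      first : proj₁ v + 0ℤ - (0ℤ + x) ≡ 0ℤ
      first = trans (cong (λ z → z + 0ℤ - (0ℤ + x)) v₁≡x) (ring x)
        where
        ring : ∀ x → x + 0ℤ - (0ℤ + x) ≡ 0ℤ
        ring = solve-∀
      second : proj₂ v + 1ℤ - (0ℤ + - c) ≡ 1ℤ + (proj₂ v + c)
      second = ring (proj₂ v) c
        where
        ring : ∀ w c → w + 1ℤ - (0ℤ + - c) ≡ 1ℤ + (w + c)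
        ring = solve-∀

  module Minimiser (M′ n : ℕ) (fl : Fin (q a (suc M′)) → Fin (q a (suc M′)))
                   (minimal : ∀ ℓ j → j ≢ fl ℓ →
                      FracLtθ (+ n + + toℕ ℓ - + toℕ (fl ℓ)) (+ n + + toℕ ℓ - + toℕ j)) where

    m : ℕ
    m = q a (suc M′)

    -- excludes the one difference f − j = s M′ q M′ whose gap may lie below T M′ + T M
    NoPartner : ℕ → Set
    NoPartner j = ∀ f → f ℕ.< m → + f - + j ≢ s M′ * + q a M′

    Below : ℕ → Form → Set
    Below j v = v <ᶠ T M′ ⊎ (v <ᶠ T M′ ⊕ T (suc M′) × NoPartner j)

    no-partner-low : ∀ {j} → s M′ ≡ -1ℤ → j ℕ.< q a M′ → NoPartner j
    no-partner-low {j} sM′≡-1 j<q′ f _ f-j≡-q′ =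
      ℕ.<⇒≱ j<q′ (ℕ.≤-trans (ℕ.m≤n+m _ f) (ℕ.≤-reflexive (ℤ.+-injective j≡f+q′)))
      where
      j≡f+q′ : + (f ℕ.+ q a M′) ≡ + j
      j≡f+q′ = begin
        + (f ℕ.+ q a M′)      ≡⟨ ℤ.pos-+ f (q a M′) ⟩
        + f + + q a M′        ≡⟨ ring₁ (+ f) (+ q a M′) ⟩
        + f - -1ℤ * + q a M′  ≡⟨ cong (λ σ → + f - σ * + q a M′) sM′≡-1 ⟨
        + f - s M′ * + q a M′ ≡⟨ cong (λ d → + f - d) f-j≡-q′ ⟨
        + f - (+ f - + j)     ≡⟨ ring₂ (+ f) (+ j) ⟩
        + j                   ∎
        where
        open ≡-Reasoning
        ring₁ : ∀ f q → f + q ≡ f - -1ℤ * q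
        ring₁ = solve-∀
        ring₂ : ∀ f j → f - (f - j) ≡ j
        ring₂ = solve-∀

    no-partner-high : ∀ {j} → s M′ ≡ 1ℤ → m ℕ.≤ j ℕ.+ q a M′ → NoPartner j
    no-partner-high {j} sM′≡1 m≤j+q′ f f<m f-j≡q′ =
      ℕ.<⇒≱ f<m (ℕ.≤-trans m≤j+q′ (ℕ.≤-reflexive (ℤ.+-injective j+q′≡f)))
      where
      j+q′≡f : + (j ℕ.+ q a M′) ≡ + f
      j+q′≡f = begin
        + (j ℕ.+ q a M′)      ≡⟨ ℤ.pos-+ j (q a M′) ⟩
        + j + + q a M′        ≡⟨ cong (_+_ (+ j)) (ℤ.*-identityˡ (+ q a M′)) ⟨
        + j + 1ℤ * + q a M′   ≡⟨ cong (λ σ → + j + σ * + q a M′) sM′≡1 ⟨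
        + j + s M′ * + q a M′ ≡⟨ cong (_+_ (+ j)) f-j≡q′ ⟨
        + j + (+ f - + j)     ≡⟨ ring (+ f) (+ j) ⟩
        + f                   ∎
        where
        open ≡-Reasoning
        ring : ∀ f j → j + (f - j) ≡ f
        ring = solve-∀

    -- If some positive v ≡ (n + ℓ − j) θ (mod 1) lies below the smallest gap
    -- {(f − j) θ} the best approximation property allows, j is the minimiser.
    minimiser-≡ : ∀ ℓ {j} → j ℕ.< m → (v : Form) → proj₁ v ≡ + n + + toℕ ℓ - + j → 0ᶠ <ᶠ v → Below j v →
                  toℕ (fl ℓ) ≡ j
    minimiser-≡ ℓ {j} j<m v v₁≡ 0<v below with toℕ (fl ℓ) ℕ.≟ j
    ... | yes fl≡j = fl≡j
    ... | no  fl≢j = ⊥-elim (refute (subst (λ i → FracLtθ (X f) (X i)) (Fin.toℕ-fromℕ< j<m)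
                                                 (minimal ℓ (fromℕ< j<m) j≢fl)))
      where
      f : ℕ
      f = toℕ (fl ℓ)
      X : ℕ → ℤ
      X i = + n + + toℕ ℓ - + i
      j≢fl : fromℕ< j<m ≢ fl ℓ
      j≢fl j≡fl = fl≢j (trans (cong toℕ (sym j≡fl)) (Fin.toℕ-fromℕ< j<m))
      E≡f-j : X j - X f ≡ + f - + j
      E≡f-j = ring (+ n) (+ toℕ ℓ) (+ f) (+ j)
        where
        ring : ∀ n ℓ f j → n + ℓ - j - (n + ℓ - f) ≡ f - j
        ring = solve-∀
      E≢0 : X j - X f ≢ 0ℤ
      E≢0 E≡0 = fl≢j (ℤ.+-injective (ℤ.i-j≡0⇒i≡j (+ f) (+ j) (trans (sym E≡f-j) E≡0)))
      E-bounds : - + m ℤ.< X j - X f × X j - X f ℤ.< + m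
      E-bounds = subst (λ e → - + m ℤ.< e × e ℤ.< + m) (sym E≡f-j) (difference-bounds (Fin.toℕ<n (fl ℓ)) j<m)
      refute : FracLtθ (X f) (X j) → ⊥
      refute (cf , cj , (0≤frac-f , _) , (_ , frac-j<1) , frac-f<frac-j) = below-contradicts-gap below
        where
        open <ᶠ-Reasoning
        gap : T M′ ≤ᶠ (X j , - cj) ⊖ (X f , - cf) ×
                  (X j - X f ≢ s M′ * + q a M′ → T M′ ⊕ T (suc M′) ≤ᶠ (X j , - cj) ⊖ (X f , - cf))
        gap = best-approximation M′ E≢0 (proj₁ E-bounds) (proj₂ E-bounds) (<ᶠ⇒0<ᶠ⊖ frac-f<frac-j)
        gap≤v : (X j , - cj) ⊖ (X f , - cf) ≤ᶠ v
        gap≤v = begin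
          (X j , - cj) ⊖ (X f , - cf) ≤⟨ x⊖y≤ᶠx _ 0≤frac-f ⟩
          (X j , - cj)                ≤⟨ frac≤ 0<v v₁≡ frac-j<1 ⟩
          v                           ∎
        below-contradicts-gap : Below j v → ⊥
        below-contradicts-gap (inj₁ v<T) = begin-contradiction
          T M′                        ≤⟨ proj₁ gap ⟩
          (X j , - cj) ⊖ (X f , - cf) ≤⟨ gap≤v ⟩
          v                           <⟨ v<T ⟩
          T M′                        ∎
        below-contradicts-gap (inj₂ (v<T+T , no-partner)) = begin-contradiction
          T M′ ⊕ T (suc M′)           ≤⟨ proj₂ gap (λ E≡ → no-partner f (Fin.toℕ<n (fl ℓ)) (trans (sym E≡f-j) E≡)) ⟩
          (X j , - cj) ⊖ (X f , - cf) ≤⟨ gap≤v ⟩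
          v                           <⟨ v<T+T ⟩
          T M′ ⊕ T (suc M′)           ∎

  -- Rotations and collisions

  module ParityCriterion (M′ n : ℕ) (fl : Fin (q a (suc M′)) → Fin (q a (suc M′)))
                         (minimal : ∀ ℓ j → j ≢ fl ℓ →
                            FracLtθ (+ n + + toℕ ℓ - + toℕ (fl ℓ)) (+ n + + toℕ ℓ - + toℕ j))
                         {b : ℕ → ℕ} (ost : IsOstrowski a n b) (0<L : 0 ℕ.< lowPart a b (suc M′))
                         (Kp : ℕ) (K-first : IsKGe b (suc M′) (suc Kp)) (2≤m : 2 ℕ.≤ q a (suc M′)) where

    open Minimiser M′ n fl minimal
    open Digits a-pos ost

    M : ℕ
    M = suc M′
    K : ℕ
    K = suc Kp
    q′ : ℕ
    q′ = q a M′
    L : ℕ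
    L = lowPart a b M
    t₀ : Form
    t₀ = T M
    t₁ : Form
    t₁ = T M′

    instance
      m-nonZero : ℕ.NonZero m
      m-nonZero = ℕ.>-nonZero (q-pos a-pos M)

    0<q′ : 0 ℕ.< q′
    0<q′ = q-pos a-pos M′

    q′<m : q′ ℕ.< m
    q′<m = q<q-suc a-pos M′ 2≤m

    L<m : L ℕ.< m
    L<m = lowPart<q M

    M≤K : M ℕ.≤ K
    M≤K = proj₁ K-first

    tail : ℕ
    tail = sumFrom (λ k → b k ℕ.* q a k) K (suc top)

    H₀ : Form
    H₀ = tailForm b K (suc top)

    h : Form
    h = s K ⊙ H₀

    H₀≡h : s K ≡ 1ℤ → H₀ ≡ h
    H₀≡h sK≡1 = trans (sym (⊙-involutive (s K) (s*s≡1 K) H₀)) (⊙-sign⁺ h sK≡1)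

    H₀≡⊝h : s K ≡ -1ℤ → H₀ ≡ ⊝ h
    H₀≡⊝h sK≡-1 = trans (sym (⊙-involutive (s K) (s*s≡1 K) H₀)) (⊙-sign⁻ h sK≡-1)

    private
      h-bounds : (+ b K - 1ℤ) ⊙ T K <ᶠ h × h <ᶠ + b K ⊙ T K ⊕ T (suc K)
      h-bounds = tail-bounds digit≤ digit-vanishes (suc top) K (ℕ.m≤n+m (suc top) K)

    0<h : 0ᶠ <ᶠ h
    0<h = begin-strict
      0ᶠ                  ≤⟨ 0≤ᶠ-⊙ (b K ℕ.∸ 1) (0<T K) ⟩
      + (b K ℕ.∸ 1) ⊙ T K ≡⟨ cong (_⊙ T K) (pos-∸ (proj₁ (proj₂ K-first))) ⟩
      (+ b K - 1ℤ) ⊙ T K  <⟨ proj₁ h-bounds ⟩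
      h                   ∎
      where open <ᶠ-Reasoning

    h<T[K-1] : h <ᶠ T Kp
    h<T[K-1] = begin-strict
      h                             <⟨ proj₂ h-bounds ⟩
      + b K ⊙ T K ⊕ T (suc K)       ≤⟨ +-monoˡ-≤ᶠ (T (suc K)) (⊙-monoˡ-≤ᶠ (digit≤ Kp) (0<T K)) ⟩
      + a (suc K) ⊙ T K ⊕ T (suc K) ≡⟨ T-rec Kp ⟨
      T Kp                          ∎
      where open <ᶠ-Reasoning

    h⊕T[K]<T[K-1] : b K ≢ a (suc K) → h ⊕ T K <ᶠ T Kp
    h⊕T[K]<T[K-1] bK≢a = begin-strict
      h ⊕ T K                       <⟨ +-monoˡ-<ᶠ (T K) (proj₂ h-bounds) ⟩
      + b K ⊙ T K ⊕ T (suc K) ⊕ T K ≡⟨ ⊕-suc-⊙ (+ b K) (T K) (T (suc K)) ⟩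
      + suc (b K) ⊙ T K ⊕ T (suc K) ≤⟨ +-monoˡ-≤ᶠ (T (suc K)) (⊙-monoˡ-≤ᶠ (ℕ.≤∧≢⇒< (digit≤ Kp) bK≢a) (0<T K)) ⟩
      + a (suc K) ⊙ T K ⊕ T (suc K) ≡⟨ T-rec Kp ⟨
      T Kp                          ∎
      where open <ᶠ-Reasoning

    h<t₁ : h <ᶠ t₁
    h<t₁ = <ᶠ-≤ᶠ-trans h<T[K-1] (T-anti (ℕ.s≤s⁻¹ M≤K))

    h<t₀ : s K ≢ s M → h <ᶠ t₀
    h<t₀ sK≢sM = <ᶠ-≤ᶠ-trans h<T[K-1] (T-anti (ℕ.s≤s⁻¹ (ℕ.≤∧≢⇒< M≤K (λ M≡K → sK≢sM (cong s (sym M≡K))))))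

    h⊕t₀<t₁ : s K ≡ s M → h ⊕ t₀ <ᶠ t₁ ⊎ b M ≡ a (suc M)
    h⊕t₀<t₁ sK≡sM with M ℕ.≟ K
    ... | yes refl with b M ℕ.≟ a (suc M)
    ...   | yes maximal = inj₂ maximal
    ...   | no ¬maximal = inj₁ (h⊕T[K]<T[K-1] ¬maximal)
    h⊕t₀<t₁ sK≡sM | no M≢K = inj₁ (begin-strict
      h ⊕ t₀         <⟨ +-monoˡ-<ᶠ t₀ (<ᶠ-≤ᶠ-trans h<T[K-1] (T-anti M+1≤Kp)) ⟩
      T (suc M) ⊕ t₀ ≡⟨ ⊕-comm (T (suc M)) t₀ ⟩
      t₀ ⊕ T (suc M) ≤⟨ T⊕T≤T M′ ⟩
      t₁             ∎)
      where
      open <ᶠ-Reasoning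
      M+1≢K : suc M ≢ K
      M+1≢K M+1≡K = s-suc≢ M (trans (cong s M+1≡K) sK≡sM)
      M+1≤Kp : suc M ℕ.≤ Kp
      M+1≤Kp = ℕ.s≤s⁻¹ (ℕ.≤∧≢⇒< (ℕ.≤∧≢⇒< M≤K M≢K) M+1≢K)

    -- (n + ℓ − j) θ ≡ H₀ + (L + ℓ − j) θ (mod 1), and L + ℓ − j is read off a
    -- balance of naturals.
    fl-lands-at : ∀ ℓ {j} → j ℕ.< m → (w : Form) {v : Form} → H₀ ⊕ w ≡ v → (d⁺ d⁻ : ℕ) →
                  L ℕ.+ toℕ ℓ ℕ.+ d⁻ ≡ j ℕ.+ d⁺ → proj₁ w ≡ + d⁺ - + d⁻ → 0ᶠ <ᶠ v → Below j v →
                  toℕ (fl ℓ) ≡ j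
    fl-lands-at ℓ {j} j<m w refl d⁺ d⁻ balance w₁≡ = minimiser-≡ ℓ j<m (H₀ ⊕ w) first-component
      where
      open ≡-Reasoning
      first-component : proj₁ H₀ + proj₁ w ≡ + n + + toℕ ℓ - + j
      first-component = begin
        proj₁ H₀ + proj₁ w               ≡⟨ cong₂ _+_ (proj₁-tailForm b K (suc top)) w₁≡ ⟩
        + tail + (+ d⁺ - + d⁻)
          ≡⟨ cong (_+_ (+ tail)) (balance⇒difference {L ℕ.+ toℕ ℓ} {j} {d⁻} {d⁺} balance) ⟨
        + tail + (+ (L ℕ.+ toℕ ℓ) - + j) ≡⟨ cong (λ x → + tail + (x - + j)) (ℤ.pos-+ L (toℕ ℓ)) ⟩
        + tail + (+ L + + toℕ ℓ - + j)   ≡⟨ regroup (+ tail) (+ L) (+ toℕ ℓ) (+ j) ⟩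
        + L + + tail + + toℕ ℓ - + j
          ≡⟨ cong (λ x → x + + toℕ ℓ - + j) (trans (sym (ℤ.pos-+ L tail)) (cong +_ (sym (n≡lowPart+tail K-first)))) ⟩
        + n + + toℕ ℓ - + j              ∎
        where
        regroup : ∀ t L ℓ j → t + (L + ℓ - j) ≡ L + t + ℓ - j
        regroup = solve-∀

    collision : ∀ {ℓ j₀} (ℓ<m : ℓ ℕ.< m) (ℓ+q′<m : ℓ ℕ.+ q′ ℕ.< m) →
                toℕ (fl (fromℕ< ℓ<m)) ≡ j₀ → toℕ (fl (fromℕ< ℓ+q′<m)) ≡ j₀ → ¬ Injective _≡_ _≡_ fl
    collision {ℓ} ℓ<m ℓ+q′<m fl[ℓ]≡j₀ fl[ℓ+q′]≡j₀ injective = ℕ.<-irrefl ℓ≡ℓ+q′ (ℕ.m<m+n ℓ 0<q′)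
      where
      ℓ≡ℓ+q′ : ℓ ≡ ℓ ℕ.+ q′
      ℓ≡ℓ+q′ = trans (sym (Fin.toℕ-fromℕ< ℓ<m))
               (trans (cong toℕ (injective (Fin.toℕ-injective (trans fl[ℓ]≡j₀ (sym fl[ℓ+q′]≡j₀)))))
                      (Fin.toℕ-fromℕ< ℓ+q′<m))

    s[M′]≡-s[M] : s M′ ≡ - s M
    s[M′]≡-s[M] = trans (sym (ℤ.neg-involutive (s M′))) (cong -_ (sym (s-suc M′)))

    module PositiveDM (sM≡1 : s M ≡ 1ℤ) where

      sM′≡-1 : s M′ ≡ -1ℤ
      sM′≡-1 = trans s[M′]≡-s[M] (cong -_ sM≡1)

      -- H₀ > 0 and D M > 0: the representative H₀ + k D M for ℓ + L = j + k m
      -- works for k = 0 and k = 1, and ℓ + L < 2 m.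
      rotation : s K ≡ 1ℤ → ∀ ℓ → toℕ (fl ℓ) ≡ (toℕ ℓ ℕ.+ L) % m
      rotation sK≡1 ℓ = by-quotient ((toℕ ℓ ℕ.+ L) / m) (m≡m%n+[m/n]*n (toℕ ℓ ℕ.+ L) m)
        where
        j : ℕ
        j = (toℕ ℓ ℕ.+ L) % m
        j<m : j ℕ.< m
        j<m = m%n<n (toℕ ℓ ℕ.+ L) m

        by-quotient : ∀ k → toℕ ℓ ℕ.+ L ≡ j ℕ.+ k ℕ.* m → toℕ (fl ℓ) ≡ j
        by-quotient zero ℓ+L≡j = fl-lands-at ℓ j<m 0ᶠ (trans (⊕-identityʳ H₀) (H₀≡h sK≡1)) 0 0
          (trans (ℕ.+-identityʳ _) (trans (ℕ.+-comm L (toℕ ℓ)) ℓ+L≡j)) refl 0<h (inj₁ h<t₁)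
        by-quotient (suc zero) ℓ+L≡j+m = fl-lands-at ℓ j<m (D M) (cong₂ _⊕_ (H₀≡h sK≡1) (D≡T sM≡1)) m 0 L+ℓ≡j+m
          (sym (ℤ.+-identityʳ (+ m))) (+-mono-<ᶠ 0<h (0<T M)) below
          where
          L+ℓ≡j+m : L ℕ.+ toℕ ℓ ℕ.+ 0 ≡ j ℕ.+ m
          L+ℓ≡j+m = trans (ℕ.+-identityʳ _)
                    (trans (ℕ.+-comm L (toℕ ℓ)) (trans ℓ+L≡j+m (cong (j ℕ.+_) (ℕ.+-identityʳ m))))
          below : Below j (h ⊕ t₀)
          below with h⊕t₀<t₁ (trans sK≡1 (sym sM≡1))
          ... | inj₁ h⊕t₀<t₁ = inj₁ h⊕t₀<t₁
          ... | inj₂ maximal = inj₂ (+-monoˡ-<ᶠ t₀ h<t₁ , no-partner-low sM′≡-1 j<q′)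
            where
            j<q′ : j ℕ.< q′
            j<q′ = ℕ.+-cancelʳ-< m j q′ (begin-strict
              j ℕ.+ m           ≡⟨ L+ℓ≡j+m ⟨
              L ℕ.+ toℕ ℓ ℕ.+ 0 ≡⟨ ℕ.+-identityʳ _ ⟩
              L ℕ.+ toℕ ℓ       <⟨ ℕ.+-mono-< (lowPart<q-pred M′ maximal) (Fin.toℕ<n ℓ) ⟩
              q′ ℕ.+ m          ∎)
              where open ℕ.≤-Reasoning
        by-quotient (suc (suc k)) ℓ+L≡j+[2+k]m = ⊥-elim (ℕ.<⇒≱ (ℕ.+-mono-< (Fin.toℕ<n ℓ) L<m) (begin
          m ℕ.+ m                 ≤⟨ ℕ.+-monoʳ-≤ m (ℕ.m≤m+n m _) ⟩
          m ℕ.+ (m ℕ.+ k ℕ.* m)   ≤⟨ ℕ.m≤n+m _ j ⟩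
          j ℕ.+ suc (suc k) ℕ.* m ≡⟨ ℓ+L≡j+[2+k]m ⟨
          toℕ ℓ ℕ.+ L             ∎))
          where open ℕ.≤-Reasoning

      -- H₀ < 0 < D M: ℓ + q′ reaches j₀ through H₀ + D M and ℓ through H₀ + D M − D M′.
      not-injective : s K ≡ -1ℤ → ¬ Injective _≡_ _≡_ fl
      not-injective sK≡-1 with collision-window-low 0<L L<m 0<q′ q′<m
      ... | ℓ , j₀ , ℓ+q′<m , j₀<q′ , L+ℓ+q′≡j₀+m = collision ℓ<m ℓ+q′<m fl[ℓ]≡j₀ fl[ℓ+q′]≡j₀
        where
        ℓ<m : ℓ ℕ.< m
        ℓ<m = ℕ.≤-<-trans (ℕ.m≤m+n ℓ q′) ℓ+q′<m
        j₀<m : j₀ ℕ.< m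
        j₀<m = ℕ.<-trans j₀<q′ q′<m
        h<t₀′ : h <ᶠ t₀
        h<t₀′ = h<t₀ (λ sK≡sM → 1≢-1 (trans (sym sM≡1) (trans (sym sK≡sM) sK≡-1)))

        fl[ℓ+q′]≡j₀ : toℕ (fl (fromℕ< ℓ+q′<m)) ≡ j₀
        fl[ℓ+q′]≡j₀ = fl-lands-at (fromℕ< ℓ+q′<m) j₀<m (D M) value m 0 balance (sym (ℤ.+-identityʳ (+ m)))
          (<ᶠ⇒0<ᶠ⊖ h<t₀′) (inj₁ (<ᶠ-trans (x⊖y<ᶠx t₀ 0<h) (T-dec M′)))
          where
          value : H₀ ⊕ D M ≡ t₀ ⊖ h
          value = trans (cong₂ _⊕_ (H₀≡⊝h sK≡-1) (D≡T sM≡1)) (⊝x⊕y≡y⊖x h t₀)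
          balance : L ℕ.+ toℕ (fromℕ< ℓ+q′<m) ℕ.+ 0 ≡ j₀ ℕ.+ m
          balance = trans (ℕ.+-identityʳ _) (trans (cong (L ℕ.+_) (Fin.toℕ-fromℕ< ℓ+q′<m))
                          (trans (sym (ℕ.+-assoc L ℓ q′)) L+ℓ+q′≡j₀+m))

        fl[ℓ]≡j₀ : toℕ (fl (fromℕ< ℓ<m)) ≡ j₀
        fl[ℓ]≡j₀ = fl-lands-at (fromℕ< ℓ<m) j₀<m (D M ⊖ D M′) value m q′ balance refl
          (<ᶠ⇒0<ᶠ⊖ (<ᶠ-trans h<t₁ (x<ᶠx⊕y t₁ (0<T M))))
          (inj₂ (x⊖y<ᶠx (t₁ ⊕ t₀) 0<h , no-partner-low sM′≡-1 j₀<q′))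
          where
          value : H₀ ⊕ (D M ⊖ D M′) ≡ (t₁ ⊕ t₀) ⊖ h
          value = trans (cong₂ _⊕_ (H₀≡⊝h sK≡-1) (cong₂ _⊖_ (D≡T sM≡1) (D≡⊝T sM′≡-1)))
                        (trans (cong (⊝ h ⊕_) (trans (x⊖⊝y≡x⊕y t₀ t₁) (⊕-comm t₀ t₁))) (⊝x⊕y≡y⊖x h (t₁ ⊕ t₀)))
          balance : L ℕ.+ toℕ (fromℕ< ℓ<m) ℕ.+ q′ ≡ j₀ ℕ.+ m
          balance = trans (cong (λ i → L ℕ.+ i ℕ.+ q′) (Fin.toℕ-fromℕ< ℓ<m)) L+ℓ+q′≡j₀+m

    module NegativeDM (sM≡-1 : s M ≡ -1ℤ) where

      sM′≡1 : s M′ ≡ 1ℤ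
      sM′≡1 = trans s[M′]≡-s[M] (cong -_ sM≡-1)

      r : ℕ
      r = m ℕ.∸ q′

      r+q′≡m : r ℕ.+ q′ ≡ m
      r+q′≡m = ℕ.m∸n+n≡m (ℕ.<⇒≤ q′<m)

      -- H₀ < 0 < D M′ and D M < 0: for ℓ + L − q′ + m = j + k m the representative
      -- H₀ + D M′ − (k − 1) D M works for k = 0, 1, 2, and k = 2 needs b M < a (M + 1).
      rotation : s K ≡ -1ℤ → ∀ ℓ → toℕ (fl ℓ) ≡ (toℕ ℓ ℕ.+ (L ℕ.+ r)) % m
      rotation sK≡-1 ℓ = by-quotient ((toℕ ℓ ℕ.+ (L ℕ.+ r)) / m) (m≡m%n+[m/n]*n (toℕ ℓ ℕ.+ (L ℕ.+ r)) m)
        where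
        x : ℕ
        x = toℕ ℓ ℕ.+ (L ℕ.+ r)
        j : ℕ
        j = x % m
        j<m : j ℕ.< m
        j<m = m%n<n x m

        L+ℓ+r≡x : L ℕ.+ toℕ ℓ ℕ.+ 0 ℕ.+ r ≡ x
        L+ℓ+r≡x = shuffle L (toℕ ℓ) r
          where
          shuffle : ∀ L ℓ r → L ℕ.+ ℓ ℕ.+ 0 ℕ.+ r ≡ ℓ ℕ.+ (L ℕ.+ r)
          shuffle = ℕ-Ring.solve-∀

        by-quotient : ∀ k → x ≡ j ℕ.+ k ℕ.* m → toℕ (fl ℓ) ≡ j
        by-quotient zero x≡j = fl-lands-at ℓ j<m (D M′ ⊖ D M) value q′ m balance refl
          (<ᶠ⇒0<ᶠ⊖ (<ᶠ-trans h<t₁ (x<ᶠx⊕y t₁ (0<T M))))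
          (inj₂ (x⊖y<ᶠx (t₁ ⊕ t₀) 0<h , no-partner-high sM′≡1 (ℕ.≤-trans (ℕ.m≤n+m m _) (ℕ.≤-reflexive balance))))
          where
          value : H₀ ⊕ (D M′ ⊖ D M) ≡ (t₁ ⊕ t₀) ⊖ h
          value = trans (cong₂ _⊕_ (H₀≡⊝h sK≡-1) (cong₂ _⊖_ (D≡T sM′≡1) (D≡⊝T sM≡-1)))
                        (trans (cong (⊝ h ⊕_) (x⊖⊝y≡x⊕y t₁ t₀)) (⊝x⊕y≡y⊖x h (t₁ ⊕ t₀)))
          balance : L ℕ.+ toℕ ℓ ℕ.+ m ≡ j ℕ.+ q′
          balance = begin
            L ℕ.+ toℕ ℓ ℕ.+ m              ≡⟨ cong (L ℕ.+ toℕ ℓ ℕ.+_) r+q′≡m ⟨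
            L ℕ.+ toℕ ℓ ℕ.+ (r ℕ.+ q′)     ≡⟨ shuffle (L ℕ.+ toℕ ℓ) r q′ ⟩
            L ℕ.+ toℕ ℓ ℕ.+ 0 ℕ.+ r ℕ.+ q′ ≡⟨ cong (ℕ._+ q′) (trans L+ℓ+r≡x x≡j) ⟩
            j ℕ.+ 0 ℕ.+ q′                 ≡⟨ cong (ℕ._+ q′) (ℕ.+-identityʳ j) ⟩
            j ℕ.+ q′                       ∎
            where
            open ≡-Reasoning
            shuffle : ∀ y r q → y ℕ.+ (r ℕ.+ q) ≡ y ℕ.+ 0 ℕ.+ r ℕ.+ q
            shuffle = ℕ-Ring.solve-∀
        by-quotient (suc zero) x≡j+m = fl-lands-at ℓ j<m (D M′) value q′ 0 balance (sym (ℤ.+-identityʳ (+ q′)))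
          (<ᶠ⇒0<ᶠ⊖ h<t₁) (inj₁ (x⊖y<ᶠx t₁ 0<h))
          where
          value : H₀ ⊕ D M′ ≡ t₁ ⊖ h
          value = trans (cong₂ _⊕_ (H₀≡⊝h sK≡-1) (D≡T sM′≡1)) (⊝x⊕y≡y⊖x h t₁)
          balance : L ℕ.+ toℕ ℓ ℕ.+ 0 ≡ j ℕ.+ q′
          balance = ℕ.+-cancelʳ-≡ r _ _ (begin
            L ℕ.+ toℕ ℓ ℕ.+ 0 ℕ.+ r ≡⟨ trans L+ℓ+r≡x x≡j+m ⟩
            j ℕ.+ 1 ℕ.* m           ≡⟨ cong (λ m′ → j ℕ.+ 1 ℕ.* m′) r+q′≡m ⟨
            j ℕ.+ 1 ℕ.* (r ℕ.+ q′)  ≡⟨ shuffle j r q′ ⟩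
            j ℕ.+ q′ ℕ.+ r          ∎)
            where
            open ≡-Reasoning
            shuffle : ∀ j r q → j ℕ.+ 1 ℕ.* (r ℕ.+ q) ≡ j ℕ.+ q ℕ.+ r
            shuffle = ℕ-Ring.solve-∀
        by-quotient (suc (suc zero)) x≡j+2m = fl-lands-at ℓ j<m (D M′ ⊕ D M) value (q′ ℕ.+ m) 0 balance
          (trans (sym (ℤ.pos-+ q′ m)) (sym (ℤ.+-identityʳ (+ (q′ ℕ.+ m))))) 0<v
          (inj₁ (<ᶠ-trans (x⊖y<ᶠx (t₁ ⊖ t₀) 0<h) (x⊖y<ᶠx t₁ (0<T M))))
          where
          value : H₀ ⊕ (D M′ ⊕ D M) ≡ (t₁ ⊖ t₀) ⊖ h
          value = trans (cong₂ _⊕_ (H₀≡⊝h sK≡-1) (cong₂ _⊕_ (D≡T sM′≡1) (D≡⊝T sM≡-1))) (⊝x⊕y≡y⊖x h (t₁ ⊖ t₀))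
          balance : L ℕ.+ toℕ ℓ ℕ.+ 0 ≡ j ℕ.+ (q′ ℕ.+ m)
          balance = ℕ.+-cancelʳ-≡ r _ _ (begin
            L ℕ.+ toℕ ℓ ℕ.+ 0 ℕ.+ r         ≡⟨ trans L+ℓ+r≡x x≡j+2m ⟩
            j ℕ.+ 2 ℕ.* m                   ≡⟨ cong (λ m′ → j ℕ.+ 2 ℕ.* m′) r+q′≡m ⟨
            j ℕ.+ 2 ℕ.* (r ℕ.+ q′)          ≡⟨ shuffle j r q′ ⟩
            j ℕ.+ (q′ ℕ.+ (r ℕ.+ q′)) ℕ.+ r ≡⟨ cong (λ m′ → j ℕ.+ (q′ ℕ.+ m′) ℕ.+ r) r+q′≡m ⟩
            j ℕ.+ (q′ ℕ.+ m) ℕ.+ r          ∎)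
            where
            open ≡-Reasoning
            shuffle : ∀ j r q → j ℕ.+ 2 ℕ.* (r ℕ.+ q) ≡ j ℕ.+ (q ℕ.+ (r ℕ.+ q)) ℕ.+ r
            shuffle = ℕ-Ring.solve-∀
          0<v : 0ᶠ <ᶠ (t₁ ⊖ t₀) ⊖ h
          0<v with h⊕t₀<t₁ (trans sK≡-1 (sym sM≡-1))
          ... | inj₁ h⊕t₀<t₁ = <ᶠ⇒0<ᶠ⊖ (subst (_<ᶠ t₁ ⊖ t₀) (x⊕y⊖y≡x h t₀) (+-monoˡ-<ᶠ (⊝ t₀) h⊕t₀<t₁))
          ... | inj₂ maximal = ⊥-elim (ℕ.<⇒≱ x<2m (begin
            m ℕ.+ m                 ≡⟨ cong (m ℕ.+_) (ℕ.+-identityʳ m) ⟨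
            m ℕ.+ (m ℕ.+ 0)         ≤⟨ ℕ.m≤n+m _ j ⟩
            j ℕ.+ (m ℕ.+ (m ℕ.+ 0)) ≡⟨ x≡j+2m ⟨
            x                       ∎))
            where
            open ℕ.≤-Reasoning
            x<2m : x ℕ.< m ℕ.+ m
            x<2m = begin-strict
              toℕ ℓ ℕ.+ (L ℕ.+ r) <⟨ ℕ.+-mono-< (Fin.toℕ<n ℓ) (ℕ.+-monoˡ-< r (lowPart<q-pred M′ maximal)) ⟩
              m ℕ.+ (q′ ℕ.+ r)    ≡⟨ cong (m ℕ.+_) (trans (ℕ.+-comm q′ r) r+q′≡m) ⟩
              m ℕ.+ m             ∎
        by-quotient (suc (suc (suc k))) x≡j+[3+k]m = ⊥-elim (ℕ.<⇒≱ x<3m (begin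
          m ℕ.+ (m ℕ.+ m)               ≤⟨ ℕ.+-monoʳ-≤ m (ℕ.+-monoʳ-≤ m (ℕ.m≤m+n m _)) ⟩
          m ℕ.+ (m ℕ.+ (m ℕ.+ k ℕ.* m)) ≤⟨ ℕ.m≤n+m _ j ⟩
          j ℕ.+ suc (suc (suc k)) ℕ.* m ≡⟨ x≡j+[3+k]m ⟨
          x                             ∎))
          where
          open ℕ.≤-Reasoning
          x<3m : x ℕ.< m ℕ.+ (m ℕ.+ m)
          x<3m = ℕ.+-mono-< (Fin.toℕ<n ℓ) (ℕ.+-mono-<-≤ L<m (ℕ.m∸n≤m m q′))

      -- H₀ > 0 > D M: ℓ reaches L + ℓ through H₀ and ℓ + q′ through H₀ + D M′.
      not-injective : s K ≡ 1ℤ → ¬ Injective _≡_ _≡_ fl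
      not-injective sK≡1 with collision-window-high 0<L L<m 0<q′ q′<m
      ... | ℓ , ℓ+q′<m , L+ℓ<m , m≤L+ℓ+q′ = collision ℓ<m ℓ+q′<m fl[ℓ]≡L+ℓ fl[ℓ+q′]≡L+ℓ
        where
        ℓ<m : ℓ ℕ.< m
        ℓ<m = ℕ.≤-<-trans (ℕ.m≤m+n ℓ q′) ℓ+q′<m
        h<t₀′ : h <ᶠ t₀
        h<t₀′ = h<t₀ (λ sK≡sM → 1≢-1 (trans (sym sK≡1) (trans sK≡sM sM≡-1)))

        fl[ℓ]≡L+ℓ : toℕ (fl (fromℕ< ℓ<m)) ≡ L ℕ.+ ℓ
        fl[ℓ]≡L+ℓ = fl-lands-at (fromℕ< ℓ<m) L+ℓ<m 0ᶠ (trans (⊕-identityʳ H₀) (H₀≡h sK≡1)) 0 0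
          (cong (λ i → L ℕ.+ i ℕ.+ 0) (Fin.toℕ-fromℕ< ℓ<m)) refl 0<h (inj₁ h<t₁)

        fl[ℓ+q′]≡L+ℓ : toℕ (fl (fromℕ< ℓ+q′<m)) ≡ L ℕ.+ ℓ
        fl[ℓ+q′]≡L+ℓ = fl-lands-at (fromℕ< ℓ+q′<m) L+ℓ<m (D M′) (cong₂ _⊕_ (H₀≡h sK≡1) (D≡T sM′≡1)) q′ 0 balance
          (sym (ℤ.+-identityʳ (+ q′))) (+-mono-<ᶠ 0<h (0<T M′))
          (inj₂ (subst (h ⊕ t₁ <ᶠ_) (⊕-comm t₀ t₁) (+-monoˡ-<ᶠ t₁ h<t₀′) , no-partner-high sM′≡1 m≤L+ℓ+q′))
          where
          balance : L ℕ.+ toℕ (fromℕ< ℓ+q′<m) ℕ.+ 0 ≡ L ℕ.+ ℓ ℕ.+ q′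
          balance = trans (ℕ.+-identityʳ _) (trans (cong (L ℕ.+_) (Fin.toℕ-fromℕ< ℓ+q′<m)) (sym (ℕ.+-assoc L ℓ q′)))

    same-sign⇒bijective : s K ≡ s M → Bijective _≡_ _≡_ fl
    same-sign⇒bijective sK≡sM with s-unit M
    ... | inj₁ sM≡1  = rotation-bijective L fl (PositiveDM.rotation sM≡1 (trans sK≡sM sM≡1))
    ... | inj₂ sM≡-1 = rotation-bijective (L ℕ.+ NegativeDM.r sM≡-1) fl (NegativeDM.rotation sM≡-1 (trans sK≡sM sM≡-1))

    injective⇒same-sign : Injective _≡_ _≡_ fl → s K ≡ s M
    injective⇒same-sign injective with s-unit M | s-unit K
    ... | inj₁ sM≡1  | inj₁ sK≡1  = trans sK≡1 (sym sM≡1)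
    ... | inj₂ sM≡-1 | inj₂ sK≡-1 = trans sK≡-1 (sym sM≡-1)
    ... | inj₁ sM≡1  | inj₂ sK≡-1 = ⊥-elim (PositiveDM.not-injective sM≡1 sK≡-1 injective)
    ... | inj₂ sM≡-1 | inj₁ sK≡1  = ⊥-elim (NegativeDM.not-injective sM≡-1 sK≡1 injective)

-- θ = ± α

alternating : ℕ → ℤ
alternating zero    = 1ℤ
alternating (suc k) = - alternating k

0≢1 : 0 ≢ 1
0≢1 ()

%2-suc-suc : ∀ k → suc (suc k) % 2 ≡ k % 2
%2-suc-suc k = trans (cong (_% 2) (ℕ.+-comm 2 k)) ([m+n]%n≡m%n k 2)

alternating-parity : ∀ k → (k % 2 ≡ 0 × alternating k ≡ 1ℤ) ⊎ (k % 2 ≡ 1 × alternating k ≡ -1ℤ)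
alternating-parity zero          = inj₁ (refl , refl)
alternating-parity (suc zero)    = inj₂ (refl , refl)
alternating-parity (suc (suc k)) with alternating-parity k
... | inj₁ (k%2≡0 , αk≡1)  = inj₁ (trans (%2-suc-suc k) k%2≡0 , trans (ℤ.neg-involutive _) αk≡1)
... | inj₂ (k%2≡1 , αk≡-1) = inj₂ (trans (%2-suc-suc k) k%2≡1 , trans (ℤ.neg-involutive _) αk≡-1)

alternating-unit : ∀ k → IsUnit (alternating k)
alternating-unit k with alternating-parity k
... | inj₁ (_ , αk≡1)  = inj₁ αk≡1
... | inj₂ (_ , αk≡-1) = inj₂ αk≡-1

alternating≡⇒parity : ∀ i j → alternating i ≡ alternating j → i % 2 ≡ j % 2
alternating≡⇒parity i j αi≡αj with alternating-parity i | alternating-parity j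
... | inj₁ (i%2≡0 , _) | inj₁ (j%2≡0 , _) = trans i%2≡0 (sym j%2≡0)
... | inj₂ (i%2≡1 , _) | inj₂ (j%2≡1 , _) = trans i%2≡1 (sym j%2≡1)
... | inj₁ (_ , αi≡1)  | inj₂ (_ , αj≡-1) = ⊥-elim (1≢-1 (trans (sym αi≡1) (trans αi≡αj αj≡-1)))
... | inj₂ (_ , αi≡-1) | inj₁ (_ , αj≡1)  = ⊥-elim (1≢-1 (trans (sym αj≡1) (trans (sym αi≡αj) αi≡-1)))

parity⇒alternating≡ : ∀ i j → i % 2 ≡ j % 2 → alternating i ≡ alternating j
parity⇒alternating≡ i j i≡j with alternating-parity i | alternating-parity j
... | inj₁ (_ , αi≡1)  | inj₁ (_ , αj≡1)  = trans αi≡1 (sym αj≡1)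
... | inj₂ (_ , αi≡-1) | inj₂ (_ , αj≡-1) = trans αi≡-1 (sym αj≡-1)
... | inj₁ (i%2≡0 , _) | inj₂ (j%2≡1 , _) = ⊥-elim (0≢1 (trans (sym i%2≡0) (trans i≡j j%2≡1)))
... | inj₂ (i%2≡1 , _) | inj₁ (j%2≡0 , _) = ⊥-elim (0≢1 (trans (sym j%2≡0) (trans (sym i≡j) i%2≡1)))

module ConvergentsOfα {a : ℕ → ℕ} (a-pos : ∀ k → 1 ℕ.≤ a (suc k)) where

  value : ℤ → ℤ → ℕ → ℤ
  value u v j = u * + p a j + v * + q a j

  value-rec : ∀ u v j → value u v (suc (suc j)) ≡ + a (suc (suc j)) * value u v (suc j) + value u v j
  value-rec u v j = trans (cong₂ (λ x y → u * x + v * y) (+p-rec a j) (+q-rec a j))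
                          (regroup u v (+ a (suc (suc j))) (+ p a (suc j)) (+ p a j) (+ q a (suc j)) (+ q a j))
    where
    regroup : ∀ u v A p₁ p₀ q₁ q₀ →
              u * (A * p₁ + p₀) + v * (A * q₁ + q₀) ≡ A * (u * p₁ + v * q₁) + (u * p₀ + v * q₀)
    regroup = solve-∀

  0<value-rec : ∀ u v j → 0ℤ ℤ.≤ value u v j → 0ℤ ℤ.< value u v (suc j) → 0ℤ ℤ.< value u v (suc (suc j))
  0<value-rec u v j 0≤vⱼ 0<vⱼ₊₁ =
    subst (0ℤ ℤ.<_) (sym (value-rec u v j)) (ℤ.+-mono-<-≤ (0<+* (a (suc (suc j))) (a-pos (suc j)) 0<vⱼ₊₁) 0≤vⱼ)
    where
    0<+* : ∀ A {y} → 1 ℕ.≤ A → 0ℤ ℤ.< y → 0ℤ ℤ.< + A * y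
    0<+* (suc A) {+[1+ y ]} _ _         = subst (0ℤ ℤ.<_) (ℤ.pos-* (suc A) (suc y)) (ℤ.+<+ (ℕ.s≤s ℕ.z≤n))
    0<+* (suc A) {+ zero}   _ (ℤ.+<+ ())

  -- PosLin a u v is Σ ℕ (PositiveAt u v).
  PositiveAt : ℤ → ℤ → ℕ → Set
  PositiveAt u v i = 0ℤ ℤ.< value u v (2 ℕ.* i) × 0ℤ ℤ.< value u v (suc (2 ℕ.* i))

  PositiveAt-suc : ∀ u v i → PositiveAt u v i → PositiveAt u v (suc i)
  PositiveAt-suc u v i (0<v₂ᵢ , 0<v₂ᵢ₊₁) =
    subst (λ j → 0ℤ ℤ.< value u v j) (sym (ℕ.*-suc 2 i)) 0<v₂ᵢ₊₂ ,
    subst (λ j → 0ℤ ℤ.< value u v (suc j)) (sym (ℕ.*-suc 2 i))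
          (0<value-rec u v (suc (2 ℕ.* i)) (ℤ.<⇒≤ 0<v₂ᵢ₊₁) 0<v₂ᵢ₊₂)
    where
    0<v₂ᵢ₊₂ : 0ℤ ℤ.< value u v (suc (suc (2 ℕ.* i)))
    0<v₂ᵢ₊₂ = 0<value-rec u v (2 ℕ.* i) (ℤ.<⇒≤ 0<v₂ᵢ) 0<v₂ᵢ₊₁

  PositiveAt-+ : ∀ u v d i → PositiveAt u v i → PositiveAt u v (d ℕ.+ i)
  PositiveAt-+ u v zero    i posᵢ = posᵢ
  PositiveAt-+ u v (suc d) i posᵢ = PositiveAt-suc u v (d ℕ.+ i) (PositiveAt-+ u v d i posᵢ)

  posLin-+ : ∀ {u v u′ v′} → PosLin a u v → PosLin a u′ v′ → PosLin a (u + u′) (v + v′)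
  posLin-+ {u} {v} {u′} {v′} (i , posᵢ) (i′ , posᵢ′) =
    i′ ℕ.+ i , add {2 ℕ.* (i′ ℕ.+ i)} (proj₁ at₁) (proj₁ at₂) , add {suc (2 ℕ.* (i′ ℕ.+ i))} (proj₂ at₁) (proj₂ at₂)
    where
    at₁ : PositiveAt u v (i′ ℕ.+ i)
    at₁ = PositiveAt-+ u v i′ i posᵢ
    at₂ : PositiveAt u′ v′ (i′ ℕ.+ i)
    at₂ = subst (PositiveAt u′ v′) (ℕ.+-comm i i′) (PositiveAt-+ u′ v′ i i′ posᵢ′)
    add : ∀ {j} → 0ℤ ℤ.< value u v j → 0ℤ ℤ.< value u′ v′ j → 0ℤ ℤ.< value (u + u′) (v + v′) j
    add {j} 0<x 0<y = subst (0ℤ ℤ.<_) (sym (regroup u v u′ v′ (+ p a j) (+ q a j))) (ℤ.+-mono-< 0<x 0<y)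
      where
      regroup : ∀ u v u′ v′ P Q → (u + u′) * P + (v + v′) * Q ≡ (u * P + v * Q) + (u′ * P + v′ * Q)
      regroup = solve-∀

  posLin-one : PosLin a 0ℤ 1ℤ
  posLin-one = 0 , ℤ.+<+ (ℕ.s≤s ℕ.z≤n) ,
               subst (0ℤ ℤ.<_) (sym (trans (ℤ.+-identityˡ _) (ℤ.*-identityˡ (+ a 1)))) (ℤ.+<+ (a-pos 0))

  posLin-const : ∀ {v} → PosLin a 0ℤ v → 0ℤ ℤ.< v
  posLin-const {v} (i , 0<v*q , _) =
    ℤ.*-cancelʳ-<-nonNeg (+ q a (2 ℕ.* i)) (subst (ℤ._< v * + q a (2 ℕ.* i)) (sym (ℤ.*-zeroˡ (+ q a (2 ℕ.* i))))
                                               (subst (0ℤ ℤ.<_) (ℤ.+-identityˡ _) 0<v*q))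

  det-α : ∀ k → + p a (suc k) * + q a k - + p a k * + q a (suc k) ≡ alternating k
  det-α zero    = refl
  det-α (suc k) = begin
    + p a (suc (suc k)) * + q a (suc k) - + p a (suc k) * + q a (suc (suc k))
      ≡⟨ cong₂ (λ x y → x * + q a (suc k) - + p a (suc k) * y) (+p-rec a k) (+q-rec a k) ⟩
    (A * + p a (suc k) + + p a k) * + q a (suc k) - + p a (suc k) * (A * + q a (suc k) + + q a k)
      ≡⟨ flip A (+ p a (suc k)) (+ p a k) (+ q a (suc k)) (+ q a k) ⟩
    - (+ p a (suc k) * + q a k - + p a k * + q a (suc k))
      ≡⟨ cong -_ (det-α k) ⟩
    - alternating k ∎
    where
    open ≡-Reasoning
    A : ℤ
    A = + a (suc (suc k))
    flip : ∀ A p₁ p₀ q₁ q₀ → (A * p₁ + p₀) * q₁ - p₁ * (A * q₁ + q₀) ≡ - (p₁ * q₀ - p₀ * q₁)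
    flip = solve-∀

  -- At the convergents k and k + 1 this form takes the values 0 and 1; the
  -- recurrence keeps it positive beyond.
  posLin-distance : ∀ k → PosLin a (alternating k * + q a k) (alternating k * - + p a k)
  posLin-distance k = suc k , subst (λ j → 0ℤ ℤ.< value σq σp j) (two-steps k) (proj₂ (grow (suc k)))
                            , subst (λ j → 0ℤ ℤ.< value σq σp j) (three-steps k) (proj₂ (grow (suc (suc k))))
    where
    σq : ℤ
    σq = alternating k * + q a k
    σp : ℤ
    σp = alternating k * - + p a k
    two-steps : ∀ k → k ℕ.+ suc (suc k) ≡ 2 ℕ.* suc k
    two-steps = ℕ-Ring.solve-∀
    three-steps : ∀ k → k ℕ.+ suc (suc (suc k)) ≡ suc (2 ℕ.* suc k)
    three-steps = ℕ-Ring.solve-∀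
    at-k : value σq σp k ≡ 0ℤ
    at-k = ring (alternating k) (+ p a k) (+ q a k)
      where
      ring : ∀ σ P Q → σ * Q * P + σ * - P * Q ≡ 0ℤ
      ring = solve-∀
    at-k+1 : value σq σp (suc k) ≡ 1ℤ
    at-k+1 = trans (ring (alternating k) (+ p a k) (+ q a k) (+ p a (suc k)) (+ q a (suc k)))
                   (trans (cong (alternating k *_) (det-α k)) (unit*unit≡1 (alternating-unit k)))
      where
      ring : ∀ σ P Q P₁ Q₁ → σ * Q * P₁ + σ * - P * Q₁ ≡ σ * (P₁ * Q - P * Q₁)
      ring = solve-∀
    grow : ∀ d → 0ℤ ℤ.≤ value σq σp (k ℕ.+ d) × 0ℤ ℤ.< value σq σp (k ℕ.+ suc d)
    grow zero = subst (λ j → 0ℤ ℤ.≤ value σq σp j) (sym (ℕ.+-identityʳ k)) (ℤ.≤-reflexive (sym at-k))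
              , subst (λ j → 0ℤ ℤ.< value σq σp j) (sym (ℕ.+-comm k 1))
                      (subst (0ℤ ℤ.<_) (sym at-k+1) (ℤ.+<+ (ℕ.s≤s ℕ.z≤n)))
    grow (suc d) = ℤ.<⇒≤ (proj₂ (grow d))
                 , subst (λ j → 0ℤ ℤ.< value σq σp j) (sym (trans (ℕ.+-suc k (suc d)) (cong suc (ℕ.+-suc k d))))
                     (0<value-rec σq σp (k ℕ.+ d) (proj₁ (grow d))
                                  (subst (λ j → 0ℤ ℤ.< value σq σp j) (ℕ.+-suc k d) (proj₂ (grow d))))

  module _ {ε : ℤ} (ε-unit : IsUnit ε) where

    ε-cancel : ∀ x → ε * (ε * x) ≡ x
    ε-cancel x = trans (sym (ℤ.*-assoc ε ε x)) (trans (cong (_* x) (unit*unit≡1 ε-unit)) (ℤ.*-identityˡ x))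

    -- θ = ε α; the numerators of θ are ε p a k and its signs ε (−1)^k.
    convergents : Convergents a
    convergents = record
      { Pos       = λ x → PosLin a (ε * proj₁ x) (proj₂ x)
      ; pos-⊕     = λ {x} {y} x>0 y>0 → subst (λ u → PosLin a u (proj₂ x + proj₂ y))
                                              (sym (ℤ.*-distribˡ-+ ε (proj₁ x) (proj₁ y)))
                                       (posLin-+ {ε * proj₁ x} {proj₂ x} {ε * proj₁ y} {proj₂ y} x>0 y>0)
      ; pos-one   = subst (λ u → PosLin a u 1ℤ) (sym (ℤ.*-zeroʳ ε)) posLin-one
      ; pos-const = λ {v} c>0 → posLin-const {v} (subst (λ u → PosLin a u v) (ℤ.*-zeroʳ ε) c>0)
      ; P         = λ k → ε * + p a k
      ; P-rec     = λ k → trans (cong (ε *_) (+p-rec a k)) (scale-rec ε (+ a (suc (suc k))) (+ p a (suc k)) (+ p a k))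
      ; s         = λ k → ε * alternating k
      ; s-suc     = λ k → sym (ℤ.neg-distribʳ-* ε (alternating k))
      ; s-unit    = λ k → unit-* ε-unit (alternating-unit k)
      ; det       = λ k → trans (scale-det ε (+ p a (suc k)) (+ p a k) (+ q a k) (+ q a (suc k)))
                                  (cong (ε *_) (det-α k))
      ; T-pos     = λ k → subst₂ (PosLin a) (sym (unscale₁ (alternating k) (+ q a k)))
                                                (sym (unscale₂ (alternating k) (+ p a k)))
                                  (posLin-distance k)
      }
      where
      scale-rec : ∀ e A x y → e * (A * x + y) ≡ A * (e * x) + e * y
      scale-rec = solve-∀
      scale-det : ∀ e x y u v → e * x * u - e * y * v ≡ e * (x * u - y * v)
      scale-det = solve-∀
      unscale₁ : ∀ σ Q → ε * (ε * σ * Q) ≡ σ * Q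
      unscale₁ σ Q = trans (sym (ℤ.*-assoc ε (ε * σ) Q)) (trans (cong (_* Q) (ε-cancel σ)) refl)
      unscale₂ : ∀ σ P → ε * σ * - (ε * P) ≡ σ * - P
      unscale₂ σ P = trans (ring ε σ P) (trans (cong (λ e → e * (σ * - P)) (unit*unit≡1 ε-unit)) (ℤ.*-identityˡ _))
        where
        ring : ∀ e σ P → e * σ * - (e * P) ≡ e * e * (σ * - P)
        ring = solve-∀
    open ConvergentTheory a-pos convergents using (_<ᶠ_; <ᶠ-intro; FracLtθ)

    fracLt⇒fracLtθ : ∀ {x y} → FracLt a (ε * x) (ε * y) → FracLtθ x y
    fracLt⇒fracLtθ {x} {y} (cx , cy , x-floor , y-floor , frac-x<frac-y) =
      cx , cy , floor x-floor , floor y-floor ,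
      <ᶠ-intro (subst₂ (PosLin a) (sym (ℤ.*-distribˡ-+ ε y (- x))) (swap cx cy) frac-x<frac-y′)
      where
      frac-x<frac-y′ : PosLin a (ε * y + ε * - x) (cx - cy)
      frac-x<frac-y′ = subst (λ u → PosLin a u (cx - cy)) (cong (_+_ (ε * y)) (ℤ.neg-distribʳ-* ε x)) frac-x<frac-y
      swap : ∀ cx cy → cx - cy ≡ - cy + - (- cx)
      swap = solve-∀
      upper₁ : ∀ e z → - (e * z) ≡ e * (0ℤ + - z)
      upper₁ = solve-∀
      upper₂ : ∀ c → c + 1ℤ ≡ 1ℤ + - (- c)
      upper₂ = solve-∀
      floor : ∀ {z c} → IsFloor a (ε * z) c → ConvergentTheory.IsFloorθ a-pos convergents z c
      floor {z} {c} (inj₁ (εz≡0 , -c≡0) , below-one) =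
        inj₂ (cong₂ _,_ (sym (trans (sym (ε-cancel z)) (trans (cong (ε *_) εz≡0) (ℤ.*-zeroʳ ε)))) (sym -c≡0)) ,
        <ᶠ-intro (subst₂ (PosLin a) (upper₁ ε z) (upper₂ c) below-one)
      floor {z} {c} (inj₂ z>c , below-one) =
        inj₁ (<ᶠ-intro (subst₂ (PosLin a) (cong (ε *_) (sym (ℤ.+-identityʳ z))) (sym (ℤ.+-identityʳ (- c))) z>c)) ,
        <ᶠ-intro (subst₂ (PosLin a) (upper₁ ε z) (upper₂ c) below-one)

open import Data.Nat using (_≤_; _<_)
open import Function.Bundles using (_⇔_; mk⇔)

lemma6p11 : (a : ℕ → ℕ) → a 0 ≡ 0 → (∀ k → 1 ≤ a (suc k)) →
    (M n : ℕ) → 2 ≤ q a M → q a M ≤ n →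
    (b : ℕ → ℕ) → IsOstrowski a n b → 0 < lowPart a b M →
    (K : ℕ) → IsKGe b M K →
    (fleft fright : Fin (q a M) → Fin (q a M)) →
    (∀ ℓ j → j ≢ fleft ℓ →
       FracLt a (+ n + + toℕ ℓ - + toℕ (fleft ℓ)) (+ n + + toℕ ℓ - + toℕ j)) →
    (∀ ℓ j → j ≢ fright ℓ →
       FracLt a (+ toℕ (fright ℓ) - (+ n + + toℕ ℓ)) (+ toℕ j - (+ n + + toℕ ℓ))) →
    (Bijective _≡_ _≡_ fleft × Bijective _≡_ _≡_ fright) ⇔ (K % 2 ≡ M % 2)
lemma6p11 a _ a-pos zero     n (ℕ.s≤s ()) _ _ _ _ _ _       _ _ _ _
lemma6p11 a _ a-pos (suc M′) n _          _ b _ _ zero    (() , _) _ _ _ _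
lemma6p11 a _ a-pos (suc M′) n 2≤m _ b ost 0<L (suc Kp) K-first fleft fright left-minimal right-minimal =
  mk⇔ (λ { ((left-injective , _) , _) →
             alternating≡⇒parity K M (unscale (left.injective⇒same-sign left-injective)) })
      (λ K≡M[2] → left.same-sign⇒bijective (cong (1ℤ *_) (parity⇒alternating≡ K M K≡M[2])) ,
                  right.same-sign⇒bijective (cong (-1ℤ *_) (parity⇒alternating≡ K M K≡M[2])))
  where
  open ConvergentsOfα {a} a-pos
  K : ℕ
  K = suc Kp
  M : ℕ
  M = suc M′
  unscale : 1ℤ * alternating K ≡ 1ℤ * alternating M → alternating K ≡ alternating M
  unscale αK≡αM = trans (sym (ℤ.*-identityˡ _)) (trans αK≡αM (ℤ.*-identityˡ _))
  negate : ∀ x y → y - x ≡ -1ℤ * (x - y)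
  negate = solve-∀
  module left  = ConvergentTheory.ParityCriterion a-pos (convergents (inj₁ refl)) M′ n fleft
                   (λ ℓ j j≢ → fracLt⇒fracLtθ (inj₁ refl)
                      (subst₂ (FracLt a) (sym (ℤ.*-identityˡ (+ n + + toℕ ℓ - + toℕ (fleft ℓ))))
                                         (sym (ℤ.*-identityˡ (+ n + + toℕ ℓ - + toℕ j)))
                              (left-minimal ℓ j j≢)))
                   ost 0<L Kp K-first 2≤m
  module right = ConvergentTheory.ParityCriterion a-pos (convergents (inj₂ refl)) M′ n fright
                   (λ ℓ j j≢ → fracLt⇒fracLtθ (inj₂ refl)
                      (subst₂ (FracLt a) (negate (+ n + + toℕ ℓ) (+ toℕ (fright ℓ)))
                                         (negate (+ n + + toℕ ℓ) (+ toℕ j))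
                              (right-minimal ℓ j j≢)))
                   ost 0<L Kp K-first 2≤m
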